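{- Let $C$ be a shortest odd cycle in a graph $H$. Let $D$ be a 4-cycle of $H$ that is edge-disjoint from $C$, and let $e_1,e_2$ be distinct edges of $D$. Then for any $C$-ear $Q_1$ containing $e_1$, there is a $C$-ear $Q_2$ containing $e_2$ with $\mathfrak C(Q_2)\prec\mathfrak C(Q_1)$.
   Context: A $C$-ear is a path $Q$ in $H$ of length at least 2 whose endpoints are two distinct vertices of $C$ and whose interior vertices do not lie on $C$. The endpoints of a $C$-ear $Q$ split $C$ into two paths of opposite parities; concatenating $Q$ with each gives two cycles of opposite parities, and $\mathfrak C(Q)$ denotes the one of odd length. For odd cycles $X,Y$ of $H$, write $Y\prec X$ if $H$ contains cycles of every odd length $\ell$ with $|X|\leq\ell\leq|Y|$ (here $|X|$ is the length of $X$; the condition is vacuous if $|Y|<|X|$). -}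

module Defs where

open import Data.Nat using (ℕ; zero; suc; _+_; _∸_; _≤_; _%_; _≡ᵇ_)
open import Data.Nat.DivMod using (_mod_)
open import Data.Fin using (Fin; toℕ)
open import Data.List using (List; []; _∷_; _++_; [_]; length; lookup; map; upTo; reverse)
open import Data.List.Membership.Propositional using (_∉_)
open import Data.List.Relation.Unary.All using (All)
open import Data.List.Relation.Unary.Unique.Propositional using (Unique)
open import Data.List.Relation.Unary.Linked using (Linked)
open import Data.Product using (Σ; _×_)
open import Data.Sum using (_⊎_)
open import Data.Bool using (if_then_else_)
open import Relation.Binary.PropositionalEquality using (_≡_)
open import Relation.Nullary using (¬_)

record Graph (n : ℕ) : Set₁ where
  field
    Adj    : Fin n → Fin n → Set
    sym    : ∀ {u v} → Adj u v → Adj v u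
    irrefl : ∀ {u} → ¬ Adj u u
open Graph public

Odd : ℕ → Set
Odd m = m % 2 ≡ 1

-- Edges traversed by a walk (given as its vertex sequence); an edge is
-- an unordered pair {a,b}.

data EdgeOn {n : ℕ} (a b : Fin n) : List (Fin n) → Set where
  here-ab : ∀ {xs} → EdgeOn a b (a ∷ b ∷ xs)
  here-ba : ∀ {xs} → EdgeOn a b (b ∷ a ∷ xs)
  there   : ∀ {x xs} → EdgeOn a b xs → EdgeOn a b (x ∷ xs)

SameEdge : {n : ℕ} → Fin n → Fin n → Fin n → Fin n → Set
SameEdge a₁ b₁ a₂ b₂ = (a₁ ≡ a₂ × b₁ ≡ b₂) ⊎ (a₁ ≡ b₂ × b₁ ≡ a₂)

-- Cycles: a cyclic sequence v₀ v₁ … v_{k-1} (k ≥ 3) of distinct vertices,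
-- consecutive ones adjacent, and v_{k-1} adjacent to v₀.

module _ {n : ℕ} (H : Graph n) where

  record Cycle : Set where
    field
      start   : Fin n
      rest    : List (Fin n)
      long    : 2 ≤ length rest
      unique  : Unique (start ∷ rest)
      closed  : Linked (Adj H) (start ∷ rest ++ [ start ])
    verts : List (Fin n)
    verts = start ∷ rest
    closedWalk : List (Fin n)
    closedWalk = start ∷ rest ++ [ start ]
    -- length (number of edges = number of vertices)
    len : ℕ
    len = length verts
    cyc : ℕ → Fin n
    cyc t = lookup verts (t mod len)
  open Cycle public

  EdgeOf : Cycle → Fin n → Fin n → Set
  EdgeOf C a b = EdgeOn a b (closedWalk C)

  EdgeDisjoint : Cycle → Cycle → Set
  EdgeDisjoint D C = ∀ a b → EdgeOf D a b → ¬ EdgeOf C a b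

  ShortestOddCycle : Cycle → Set
  ShortestOddCycle C = Odd (len C) × (∀ (C' : Cycle) → Odd (len C') → len C ≤ len C')

  -- Y ≺ X (for odd cycles given by their lengths |Y|, |X|):
  -- H has cycles of every odd length ℓ with |X| ≤ ℓ ≤ |Y|.
  Prec : ℕ → ℕ → Set
  Prec lenY lenX = ∀ ℓ → Odd ℓ → lenX ≤ ℓ → ℓ ≤ lenY → Σ Cycle λ Z → len Z ≡ ℓ

  -- C-ears: a path first, interior…, final of length ≥ 2 in H, whose
  -- endpoints are (distinct, by path-ness) vertices of C with indices i, j,
  -- and whose interior vertices are not on C.

  module _ (C : Cycle) where

    record Ear : Set where
      field
        first    : Fin n
        interior : List (Fin n)
        final    : Fin n
        nonTriv  : 1 ≤ length interior
        uniqueQ  : Unique (first ∷ interior ++ [ final ])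
        path     : Linked (Adj H) (first ∷ interior ++ [ final ])
        i        : Fin (len C)
        j        : Fin (len C)
        first≡   : first ≡ lookup (verts C) i
        final≡   : final ≡ lookup (verts C) j
        offC     : All (λ v → v ∉ verts C) interior
      earVerts : List (Fin n)
      earVerts = first ∷ interior ++ [ final ]

    open Ear public

    dist : Fin (len C) → Fin (len C) → ℕ
    dist a b = (toℕ b + len C ∸ toℕ a) % len C

    arcInterior : Fin (len C) → Fin (len C) → List (Fin n)
    arcInterior a b = map (λ t → cyc C (toℕ a + suc t)) (upTo (dist a b ∸ 1))

    -- The two cycles formed by Q and the two C-paths between its ends
    -- (as cyclic vertex sequences): Q followed by the forward C-path from
    -- final back to first, resp. by the backward C-path from final to first.
    earCycle₁ earCycle₂ : Ear → List (Fin n)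
    earCycle₁ Q = earVerts Q ++ arcInterior (j Q) (i Q)
    earCycle₂ Q = earVerts Q ++ reverse (arcInterior (i Q) (j Q))

    𝔠 : Ear → List (Fin n)
    𝔠 Q = if length (earCycle₁ Q) % 2 ≡ᵇ 1 then earCycle₁ Q else earCycle₂ Q

-- Let Q₁ contain the edge xw of the 4-cycle x w y z, say Q₁ = u ⋯ x w ⋯ v, and write 𝔠(Q₁) = Q₁ + K with K an arc of C.
-- Two facts about a shortest odd cycle C drive the proof. First, 𝔠(Q) is the shortest odd closure of an ear Q: if Q + T is
-- an odd closed walk then |𝔠(Q)| ≤ |Q + T|, because T followed by the other arc of C is an odd closed walk, hence at least
-- |C| long. Second, |𝔠(Q)| < |Q| + |C|. Rerouting Q₁ through y, and if need be through z, gives an ear Q₂ through wy, a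
-- closure T of Q₂ and possibly a closed walk L, whose lengths add up to |𝔠(Q₁)| + 2 or |𝔠(Q₁)| + 4. This sum is odd, so
-- Q₂ + T or L is odd, and either way |𝔠(Q₂)| ≤ |𝔠(Q₁)| + 2; as both lengths are odd, 𝔠(Q₂) ≺ 𝔠(Q₁). The edge opposite
-- to e₁ is reached in two such steps, ≺ being transitive.

module Submission where

open import Defs hiding (sym)
open import Data.Nat using (ℕ; zero; suc; pred; _+_; _∸_; _≤_; _<_; _%_; _/_; _*_; _≡ᵇ_; z≤n; s≤s; _<?_; _≤?_)
open import Data.Nat.Properties hiding (_≟_)
open import Data.Nat.DivMod
open import Data.Nat.Induction using (<-rec)
open import Data.Nat.Tactic.RingSolver using (solve-∀)
open import Data.Bool using (Bool; true; false; not; _xor_; if_then_else_)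
open import Data.Bool.Properties using (not-involutive; xor-identityʳ)
open import Data.Fin using (Fin; toℕ)
import Data.Fin as Fin
open import Data.Fin.Properties using (_≟_; toℕ-fromℕ<; toℕ<n; toℕ-injective)
open import Data.List using (List; []; _∷_; _++_; [_]; length; reverse; lookup; map; applyUpTo; upTo)
open import Data.List.Properties
  using (++-assoc; reverse-++; unfold-reverse; ∷-injective; length-++; length-++-sucʳ; length-++-comm; length-reverse; length-map; length-upTo; map-upTo; applyUpTo-∷ʳ)
open import Data.List.Membership.Propositional using (_∈_; _∉_)
open import Data.List.Membership.Propositional.Properties using (∈-++⁺ˡ; ∈-++⁺ʳ; ∈-++⁻; ∈-∃++; ∈-lookup; ∈-map⁻)
open import Data.List.Relation.Unary.Any using (here; there; index)
open import Data.List.Relation.Unary.Any.Properties using (reverse⁻; lookup-index)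
open import Data.List.Relation.Unary.All using (All; _∷_)
import Data.List.Relation.Unary.All as All
open import Data.List.Relation.Unary.Unique.Propositional using (Unique; []; _∷_)
import Data.List.Relation.Unary.Unique.Propositional.Properties as Unique
open import Data.List.Relation.Unary.Linked using (Linked; []; [-]; _∷_)
import Data.List.Relation.Unary.Linked.Properties as Linked
open import Data.Product using (Σ; _×_; _,_; proj₁; proj₂)
open import Data.Sum using (_⊎_; inj₁; inj₂)
import Data.Sum
open import Data.Empty using (⊥-elim)
open import Function using (_∘_; case_of_)
open import Relation.Binary.Definitions using (DecidableEquality; tri<; tri≈; tri>)
open import Relation.Binary.PropositionalEquality hiding ([_])
open import Relation.Nullary using (¬_; yes; no)

private variable
  A : Set
  x y z : A
  xs ys zs : List A

nth : List A → ℕ → A → A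
nth []       k       d = d
nth (x ∷ xs) zero    d = x
nth (x ∷ xs) (suc k) d = nth xs k d

lookup≡nth : (xs : List A) (k : Fin (length xs)) (d : A) → lookup xs k ≡ nth xs (toℕ k) d
lookup≡nth (x ∷ xs) Fin.zero    d = refl
lookup≡nth (x ∷ xs) (Fin.suc k) d = lookup≡nth xs k d

nth-++ˡ : (xs ys : List A) {k : ℕ} (d : A) → k < length xs → nth (xs ++ ys) k d ≡ nth xs k d
nth-++ˡ (x ∷ xs) ys {zero}  d _       = refl
nth-++ˡ (x ∷ xs) ys {suc k} d (s≤s p) = nth-++ˡ xs ys d p

nth-++ʳ : (xs ys : List A) (k : ℕ) (d : A) → nth (xs ++ ys) (length xs + k) d ≡ nth ys k d
nth-++ʳ []       ys k d = refl
nth-++ʳ (x ∷ xs) ys k d = nth-++ʳ xs ys k d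

nth∈ : (xs : List A) {k : ℕ} (d : A) → k < length xs → nth xs k d ∈ xs
nth∈ (x ∷ xs) {zero}  d _       = here refl
nth∈ (x ∷ xs) {suc k} d (s≤s p) = there (nth∈ xs d p)

StartsWith : {A : Set} → A → List A → Set
StartsWith {A} s L = Σ (List A) λ M → L ≡ s ∷ M

EndsWith : {A : Set} → A → List A → Set
EndsWith {A} t L = Σ (List A) λ M → L ≡ M ++ [ t ]

startsWith-++ : StartsWith x xs → StartsWith x (xs ++ ys)
startsWith-++ {ys = ys} (M , refl) = M ++ ys , refl

endsWith-++ : (xs : List A) → EndsWith y ys → EndsWith y (xs ++ ys)
endsWith-++ {y = y} xs (M , refl) = xs ++ M , sym (++-assoc xs M [ y ])

endsWith-∷ : EndsWith y ys → EndsWith y (x ∷ ys)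
endsWith-∷ = endsWith-++ [ _ ]

startsWith-splice : (xs : List A) → StartsWith x (xs ++ y ∷ ys) → StartsWith x (xs ++ y ∷ zs)
startsWith-splice []       (_ , refl) = _ , refl
startsWith-splice (_ ∷ xs) (_ , refl) = _ , refl

endsWith-suffix : (xs : List A) → EndsWith x (xs ++ y ∷ ys) → EndsWith x (y ∷ ys)
endsWith-suffix []           e            = e
endsWith-suffix (_ ∷ [])     ([] , ())
endsWith-suffix (_ ∷ _ ∷ _)  ([] , ())
endsWith-suffix (_ ∷ xs)     (_ ∷ M , e) = endsWith-suffix xs (M , proj₂ (∷-injective e))

startsWith-∈ : StartsWith x xs → x ∈ xs
startsWith-∈ (_ , refl) = here refl

endsWith-∈ : EndsWith x xs → x ∈ xs
endsWith-∈ (M , refl) = ∈-++⁺ʳ M (here refl)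

startsEnds⇒sandwich : StartsWith x xs → EndsWith y xs → 2 ≤ length xs → Σ (List A) λ M → xs ≡ x ∷ M ++ [ y ]
startsEnds⇒sandwich (_ , refl) ([] , refl) (s≤s ())
startsEnds⇒sandwich (_ , refl) (_ ∷ M , e) _ = M , cong (_ ∷_) (proj₂ (∷-injective e))

reverse-∷-++ : (a : A) (xs : List A) (b : A) → reverse (a ∷ xs ++ [ b ]) ≡ b ∷ reverse xs ++ [ a ]
reverse-∷-++ a xs b = trans (unfold-reverse a (xs ++ [ b ])) (cong (_++ [ a ]) (reverse-++ xs [ b ]))

reverse-++-∷-∷ : (xs : List A) (x y : A) (ys : List A) → reverse (xs ++ x ∷ y ∷ ys) ≡ reverse ys ++ y ∷ x ∷ reverse xs
reverse-++-∷-∷ xs x y ys = begin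
  reverse (xs ++ x ∷ y ∷ ys)                  ≡⟨ reverse-++ xs (x ∷ y ∷ ys) ⟩
  reverse (x ∷ y ∷ ys) ++ reverse xs          ≡⟨ cong (_++ reverse xs) (unfold-reverse x (y ∷ ys)) ⟩
  (reverse (y ∷ ys) ++ [ x ]) ++ reverse xs   ≡⟨ cong (λ t → (t ++ [ x ]) ++ reverse xs) (unfold-reverse y ys) ⟩
  ((reverse ys ++ [ y ]) ++ [ x ]) ++ reverse xs ≡⟨ ++-assoc (reverse ys ++ [ y ]) [ x ] (reverse xs) ⟩
  (reverse ys ++ [ y ]) ++ x ∷ reverse xs     ≡⟨ ++-assoc (reverse ys) [ y ] (x ∷ reverse xs) ⟩
  reverse ys ++ y ∷ x ∷ reverse xs            ∎
  where open ≡-Reasoning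

module _ {R : A → A → Set} where

  linked-++⁻ˡ : (xs : List A) → Linked R (xs ++ ys) → Linked R xs
  linked-++⁻ˡ []           l       = []
  linked-++⁻ˡ (x ∷ [])     l       = [-]
  linked-++⁻ˡ (x ∷ y ∷ xs) (r ∷ l) = r ∷ linked-++⁻ˡ (y ∷ xs) l

  linked-++⁻ʳ : (xs : List A) → Linked R (xs ++ ys) → Linked R ys
  linked-++⁻ʳ []           l       = l
  linked-++⁻ʳ (x ∷ [])     [-]     = []
  linked-++⁻ʳ (x ∷ [])     (_ ∷ l) = l
  linked-++⁻ʳ (x ∷ y ∷ xs) (_ ∷ l) = linked-++⁻ʳ (y ∷ xs) l

  linked-prefix : (xs : List A) → Linked R (xs ++ x ∷ ys) → Linked R (xs ++ [ x ])
  linked-prefix {x = x} {ys = ys} xs l = linked-++⁻ˡ (xs ++ [ x ]) (subst (Linked R) (sym (++-assoc xs [ x ] ys)) l)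

  linked-join : (xs : List A) → Linked R (xs ++ [ x ]) → Linked R (x ∷ ys) → Linked R (xs ++ x ∷ ys)
  linked-join []           l       m = m
  linked-join (x ∷ [])     (r ∷ _) m = r ∷ m
  linked-join (x ∷ y ∷ xs) (r ∷ l) m = r ∷ linked-join (y ∷ xs) l m

  linked-snoc : (xs : List A) → Linked R (xs ++ [ x ]) → R x y → Linked R ((xs ++ [ x ]) ++ [ y ])
  linked-snoc {x = x} {y = y} xs l r =
    subst (Linked R) (sym (++-assoc xs [ x ] [ y ])) (linked-join xs l (r ∷ [-]))

  linked-glue : EndsWith y xs → Linked R xs → Linked R (y ∷ ys) → Linked R (xs ++ ys)
  linked-glue {y = y} {ys = ys} (M , refl) l m = subst (Linked R) (sym (++-assoc M [ y ] ys)) (linked-join M l m)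

  closedWalk-rotate : (as ss : List A) → Linked R (x ∷ (as ++ y ∷ ss) ++ [ x ]) → Linked R (y ∷ (ss ++ x ∷ as) ++ [ y ])
  closedWalk-rotate {x = x} {y = y} as ss l =
    subst (λ t → Linked R (y ∷ t)) (sym (++-assoc ss (x ∷ as) [ y ]))
      (linked-join (y ∷ ss) (linked-++⁻ʳ (x ∷ as) l′) (linked-prefix (x ∷ as) l′))
    where
    l′ : Linked R (x ∷ as ++ y ∷ ss ++ [ x ])
    l′ = subst (λ t → Linked R (x ∷ t)) (++-assoc as (y ∷ ss) [ x ]) l

  closedWalk-split : (bs es : List A) → Linked R (y ∷ (bs ++ y ∷ es) ++ [ y ]) →
                     Linked R (y ∷ bs ++ [ y ]) × Linked R (y ∷ es ++ [ y ])
  closedWalk-split {y = y} bs es l = linked-prefix (y ∷ bs) l′ , linked-++⁻ʳ (y ∷ bs) l′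
    where
    l′ : Linked R (y ∷ bs ++ y ∷ es ++ [ y ])
    l′ = subst (λ t → Linked R (y ∷ t)) (++-assoc bs (y ∷ es) [ y ]) l

  linked-nth : (xs : List A) {k : ℕ} (d : A) → Linked R xs → suc k < length xs →
               R (nth xs k d) (nth xs (suc k) d)
  linked-nth (x ∷ y ∷ xs) {zero}  d (r ∷ l) _       = r
  linked-nth (x ∷ y ∷ xs) {suc k} d (r ∷ l) (s≤s p) = linked-nth (y ∷ xs) d l p
  linked-nth (x ∷ [])             d [-]     (s≤s ())

  linked-reverse⁺ : (∀ {a b} → R a b → R b a) → Linked R xs → Linked R (reverse xs)
  linked-reverse⁺ sym-R []                  = []
  linked-reverse⁺ sym-R [-]                 = [-]
  linked-reverse⁺ sym-R (_∷_ {x} {y} {xs} r l) = subst (Linked R) (sym (unfold-reverse x (y ∷ xs)))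
    (linked-glue (reverse xs , unfold-reverse y xs) (linked-reverse⁺ sym-R l) (sym-R r ∷ [-]))

unique-∷⁺ : x ∉ xs → Unique xs → Unique (x ∷ xs)
unique-∷⁺ {xs = xs} x∉ u = All.tabulate (λ {y} y∈ x≡y → x∉ (subst (_∈ xs) (sym x≡y) y∈)) ∷ u

unique-∷⁻ : Unique (x ∷ xs) → x ∉ xs × Unique xs
unique-∷⁻ (x≢ ∷ u) = (λ x∈ → All.lookup x≢ x∈ refl) , u

unique-++⁻ : (xs : List A) → Unique (xs ++ ys) → Unique xs × Unique ys × (∀ {v} → v ∈ xs → v ∉ ys)
unique-++⁻ []       u = [] , u , λ ()
unique-++⁻ (x ∷ xs) u with unique-∷⁻ u
... | x∉ , u′ with unique-++⁻ xs u′
...   | uxs , uys , disj =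
  unique-∷⁺ (x∉ ∘ ∈-++⁺ˡ) uxs , uys ,
  λ { (here refl) v∈ → x∉ (∈-++⁺ʳ xs v∈) ; (there v∈xs) → disj v∈xs }

unique-++⁺ : (xs : List A) → Unique xs → Unique ys → (∀ {v} → v ∈ xs → v ∉ ys) → Unique (xs ++ ys)
unique-++⁺ []       _  uys _    = uys
unique-++⁺ (x ∷ xs) ux uys disj with unique-∷⁻ ux
... | x∉ , uxs = unique-∷⁺ x∉xs++ys (unique-++⁺ xs uxs uys (disj ∘ there))
  where
  x∉xs++ys : x ∉ xs ++ _
  x∉xs++ys x∈ with ∈-++⁻ xs x∈
  ... | inj₁ x∈xs = x∉ x∈xs
  ... | inj₂ x∈ys = disj (here refl) x∈ys

unique-reverse⁺ : Unique xs → Unique (reverse xs)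
unique-reverse⁺ {xs = []}     u = u
unique-reverse⁺ {xs = x ∷ xs} u with unique-∷⁻ u
... | x∉ , uxs = subst Unique (sym (unfold-reverse x xs))
  (unique-++⁺ (reverse xs) (unique-reverse⁺ uxs) (unique-∷⁺ (λ ()) [])
    (λ { v∈ (here refl) → x∉ (reverse⁻ v∈) }))

unique-dropMiddle : (xs ms ys : List A) → Unique (xs ++ ms ++ ys) → Unique (xs ++ ys)
unique-dropMiddle xs ms ys u with unique-++⁻ xs u
... | uxs , ums-ys , disj = unique-++⁺ xs uxs (proj₁ (proj₂ (unique-++⁻ ms ums-ys))) (λ v∈ v∈ys → disj v∈ (∈-++⁺ʳ ms v∈ys))

unique-cut : (xs ms : List A) → Unique (xs ++ y ∷ ms ++ ys) → Unique (xs ++ y ∷ ys)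
unique-cut {y = y} {ys = ys} xs ms u =
  subst Unique (++-assoc xs [ y ] ys)
    (unique-dropMiddle (xs ++ [ y ]) ms ys (subst Unique (sym (++-assoc xs [ y ] (ms ++ ys))) u))

unique-insert : (xs ys : List A) → Unique (xs ++ ys) → y ∉ xs ++ ys → Unique (xs ++ y ∷ ys)
unique-insert xs ys u y∉ with unique-++⁻ xs u
... | uxs , uys , disj = unique-++⁺ xs uxs (unique-∷⁺ (y∉ ∘ ∈-++⁺ʳ xs) uys)
  (λ { v∈ (here refl) → y∉ (∈-++⁺ˡ v∈) ; v∈ (there v∈ys) → disj v∈ v∈ys })

unique-insertAfter : (xs : List A) → Unique (xs ++ x ∷ ys) → y ∉ xs ++ x ∷ ys → Unique (xs ++ x ∷ y ∷ ys)
unique-insertAfter {x = x} {ys = ys} {y = y} xs u y∉ =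
  subst Unique (++-assoc xs [ x ] (y ∷ ys))
    (unique-insert (xs ++ [ x ]) ys (subst Unique (sym (++-assoc xs [ x ] ys)) u) (y∉ ∘ subst (y ∈_) (++-assoc xs [ x ] ys)))

nth-injective : (xs : List A) (d : A) → Unique xs → ∀ {k l} → k < length xs → l < length xs →
                nth xs k d ≡ nth xs l d → k ≡ l
nth-injective (x ∷ xs) d u {zero}  {zero}  _       _       _ = refl
nth-injective (x ∷ xs) d u {zero}  {suc l} _       (s≤s q) e = ⊥-elim (proj₁ (unique-∷⁻ u) (subst (_∈ xs) (sym e) (nth∈ xs d q)))
nth-injective (x ∷ xs) d u {suc k} {zero}  (s≤s p) _       e = ⊥-elim (proj₁ (unique-∷⁻ u) (subst (_∈ xs) e (nth∈ xs d p)))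
nth-injective (x ∷ xs) d u {suc k} {suc l} (s≤s p) (s≤s q) e = cong suc (nth-injective xs d (proj₂ (unique-∷⁻ u)) p q e)

module _ (_≟_ : DecidableEquality A) where
  open import Data.List.Membership.DecPropositional _≟_ using (_∈?_)

  unique⊎repeat : (xs : List A) → Unique xs ⊎
    Σ (List A) λ as → Σ A λ y → Σ (List A) λ bs → Σ (List A) λ es → xs ≡ as ++ y ∷ bs ++ y ∷ es
  unique⊎repeat []       = inj₁ []
  unique⊎repeat (x ∷ xs) with x ∈? xs
  ... | yes x∈ with ∈-∃++ x∈
  ...   | bs , es , refl = inj₂ ([] , x , bs , es , refl)
  unique⊎repeat (x ∷ xs) | no x∉ with unique⊎repeat xs
  ... | inj₁ u                            = inj₁ (unique-∷⁺ x∉ u)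
  ... | inj₂ (as , y , bs , es , refl) = inj₂ (x ∷ as , y , bs , es , refl)

∈-cut : (xs ms : List A) → x ∈ xs ++ y ∷ ys → x ∈ xs ++ y ∷ ms ++ ys
∈-cut xs ms x∈ with ∈-++⁻ xs x∈
... | inj₁ x∈xs          = ∈-++⁺ˡ x∈xs
... | inj₂ (here refl)   = ∈-++⁺ʳ xs (here refl)
... | inj₂ (there x∈ys)  = ∈-++⁺ʳ xs (there (∈-++⁺ʳ ms x∈ys))

∈-remove : (xs : List A) → x ∈ xs ++ y ∷ ys → x ≡ y ⊎ x ∈ xs ++ ys
∈-remove xs x∈ with ∈-++⁻ xs x∈
... | inj₁ x∈xs         = inj₂ (∈-++⁺ˡ x∈xs)
... | inj₂ (here x≡y)   = inj₁ x≡y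
... | inj₂ (there x∈ys) = inj₂ (∈-++⁺ʳ xs x∈ys)

∈-removeAfter : (xs : List A) → z ∈ xs ++ x ∷ y ∷ ys → z ≡ y ⊎ z ∈ xs ++ x ∷ ys
∈-removeAfter {x = x} {y = y} {ys = ys} xs z∈ with ∈-remove (xs ++ [ x ]) (subst (_ ∈_) (sym (++-assoc xs [ x ] (y ∷ ys))) z∈)
... | inj₁ z≡y  = inj₁ z≡y
... | inj₂ z∈′  = inj₂ (subst (_ ∈_) (++-assoc xs [ x ] ys) z∈′)

private variable
  m : ℕ
  p q : Fin m
  ws : List (Fin m)

EdgeOn-sym : EdgeOn p q ws → EdgeOn q p ws
EdgeOn-sym here-ab   = here-ba
EdgeOn-sym here-ba   = here-ab
EdgeOn-sym (there e) = there (EdgeOn-sym e)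

EdgeOn-++⁺ʳ : (xs : List (Fin m)) → EdgeOn p q ws → EdgeOn p q (xs ++ ws)
EdgeOn-++⁺ʳ []       e = e
EdgeOn-++⁺ʳ (x ∷ xs) e = there (EdgeOn-++⁺ʳ xs e)

EdgeOn-nth : (xs : List (Fin m)) {k : ℕ} (d : Fin m) → suc k < length xs → EdgeOn (nth xs k d) (nth xs (suc k) d) xs
EdgeOn-nth (x ∷ y ∷ xs) {zero}  d _       = here-ab
EdgeOn-nth (x ∷ y ∷ xs) {suc k} d (s≤s p) = there (EdgeOn-nth (y ∷ xs) d p)
EdgeOn-nth (x ∷ [])             d (s≤s ())

EdgeOn⇒split : EdgeOn p q ws → Σ (List (Fin m)) λ xs → Σ (List (Fin m)) λ ys →
               ws ≡ xs ++ p ∷ q ∷ ys ⊎ ws ≡ xs ++ q ∷ p ∷ ys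
EdgeOn⇒split (here-ab {ys}) = [] , ys , inj₁ refl
EdgeOn⇒split (here-ba {ys}) = [] , ys , inj₂ refl
EdgeOn⇒split (there {x} e) with EdgeOn⇒split e
... | xs , ys , inj₁ refl = x ∷ xs , ys , inj₁ refl
... | xs , ys , inj₂ refl = x ∷ xs , ys , inj₂ refl

EdgeOn⇒2≤length : EdgeOn p q ws → 2 ≤ length ws
EdgeOn⇒2≤length here-ab   = s≤s (s≤s z≤n)
EdgeOn⇒2≤length here-ba   = s≤s (s≤s z≤n)
EdgeOn⇒2≤length (there e) = m≤n⇒m≤1+n (EdgeOn⇒2≤length e)

EdgeOn-rotate₄ : ∀ {a b c d : Fin m} → EdgeOn p q (a ∷ b ∷ c ∷ d ∷ a ∷ []) → EdgeOn p q (b ∷ c ∷ d ∷ a ∷ b ∷ [])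
EdgeOn-rotate₄ here-ab                             = there (there (there here-ab))
EdgeOn-rotate₄ here-ba                             = there (there (there here-ba))
EdgeOn-rotate₄ (there here-ab)                     = here-ab
EdgeOn-rotate₄ (there here-ba)                     = here-ba
EdgeOn-rotate₄ (there (there here-ab))             = there here-ab
EdgeOn-rotate₄ (there (there here-ba))             = there here-ba
EdgeOn-rotate₄ (there (there (there here-ab)))     = there (there here-ab)
EdgeOn-rotate₄ (there (there (there here-ba)))     = there (there here-ba)
EdgeOn-rotate₄ (there (there (there (there (there ())))))

parity : ℕ → Bool
parity zero    = false
parity (suc n) = not (parity n)

parity-+ : ∀ m n → parity (m + n) ≡ parity m xor parity n
parity-+ zero    n = refl
parity-+ (suc m) n rewrite parity-+ m n with parity m
... | true  = not-involutive (parity n)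
... | false = refl

parity-+2 : ∀ m → parity (m + 2) ≡ parity m
parity-+2 m = trans (parity-+ m 2) (xor-identityʳ (parity m))

%2-suc-suc : ∀ m → suc (suc m) % 2 ≡ m % 2
%2-suc-suc m = trans (cong (_% 2) (+-comm 2 m)) ([m+n]%n≡m%n m 2)

odd?≡parity : ∀ m → (m % 2 ≡ᵇ 1) ≡ parity m
odd?≡parity zero          = refl
odd?≡parity (suc zero)    = refl
odd?≡parity (suc (suc m)) rewrite %2-suc-suc m | odd?≡parity m = sym (not-involutive (parity m))

Odd⇒parity : ∀ m → Odd m → parity m ≡ true
Odd⇒parity m odd = trans (sym (odd?≡parity m)) (cong (_≡ᵇ 1) odd)

parity⇒Odd : ∀ m → parity m ≡ true → Odd m
parity⇒Odd zero          ()
parity⇒Odd (suc zero)    _ = refl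
parity⇒Odd (suc (suc m)) p rewrite %2-suc-suc m = parity⇒Odd m (trans (sym (not-involutive (parity m))) p)

parity-+-odd : ∀ m n → parity (m + n) ≡ true → parity m ≡ true ⊎ parity n ≡ true
parity-+-odd m n p rewrite parity-+ m n with parity m | parity n
... | true  | _     = inj₁ refl
... | false | true  = inj₂ refl
... | false | false = case p of λ ()

parity-cancelˡ : ∀ e a b → parity (e + a) ≡ parity (e + b) → ∀ f → parity (a + f) ≡ parity (b + f)
parity-cancelˡ e a b p f rewrite parity-+ e a | parity-+ e b | parity-+ a f | parity-+ b f =
  cong (_xor parity f) (xor-injective (parity e) p)
  where
  xor-injective : ∀ x {y z} → x xor y ≡ x xor z → y ≡ z
  xor-injective false p = p
  xor-injective true  p = trans (sym (not-involutive _)) (trans (cong not p) (not-involutive _))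

parity-even⇒swap : ∀ e a b → parity (e + a) ≡ false → parity (e + b) ≡ parity (a + b)
parity-even⇒swap e a b p rewrite parity-+ e a | parity-+ e b | parity-+ a b with parity e | parity a
... | false | false = refl
... | true  | true  = refl
... | false | true  = case p of λ ()
... | true  | false = case p of λ ()

parity-suc-suc : ∀ m → parity (suc (suc m)) ≡ parity m
parity-suc-suc m = not-involutive (parity m)

-- Odd closed walks contain odd cycles

length-rotate : ∀ {A : Set} (as : List A) {x y : A} (ss : List A) → length (as ++ y ∷ ss) ≡ length (ss ++ x ∷ as)
length-rotate as {x} {y} ss =
  trans (length-++-sucʳ as y ss) (trans (cong suc (length-++-comm as ss)) (sym (length-++-sucʳ ss x as)))

summands< : ∀ {l b e} → suc l ≡ suc b + suc e → b < l × e < l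
summands< {b = b} {e} refl = subst (suc b ≤_) (sym (+-suc b e)) (s≤s (m≤m+n b e)) , m≤n+m (suc e) b

module _ {n : ℕ} (H : Graph n) where

  -- x ∷ L traversed cyclically; its length is suc (length L)
  ClosedWalk : Fin n → List (Fin n) → Set
  ClosedWalk x L = Linked (Adj H) (x ∷ L ++ [ x ])

  closedWalk-decompose : ∀ {x} L → ClosedWalk x L → Unique (x ∷ L) ⊎
    Σ (Fin n) λ y → Σ (List (Fin n)) λ B → Σ (List (Fin n)) λ E →
      ClosedWalk y B × ClosedWalk y E × suc (length L) ≡ suc (length B) + suc (length E)
  closedWalk-decompose {x} L w with unique⊎repeat _≟_ (x ∷ L)
  ... | inj₁ u = inj₁ u
  ... | inj₂ ([] , y , bs , es , refl) =
    inj₂ (y , bs , es , proj₁ halves , proj₂ halves , cong suc (length-++ bs))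
    where
    halves : ClosedWalk y bs × ClosedWalk y es
    halves = closedWalk-split bs es w
  ... | inj₂ (_ ∷ as , y , bs , es , refl) =
    inj₂ (y , bs , es ++ x ∷ as , proj₁ halves , proj₂ halves , cong suc lengths)
    where
    rotated : ClosedWalk y (bs ++ y ∷ es ++ x ∷ as)
    rotated = subst (ClosedWalk y) (++-assoc bs (y ∷ es) (x ∷ as)) (closedWalk-rotate as (bs ++ y ∷ es) w)
    halves : ClosedWalk y bs × ClosedWalk y (es ++ x ∷ as)
    halves = closedWalk-split bs (es ++ x ∷ as) rotated
    lengths : length (as ++ y ∷ bs ++ y ∷ es) ≡ length bs + suc (length (es ++ x ∷ as))
    lengths = trans (length-rotate as (bs ++ y ∷ es))
                (trans (cong length (++-assoc bs (y ∷ es) (x ∷ as))) (length-++ bs))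

  uniqueOddClosedWalk⇒cycle : ∀ {x} L → ClosedWalk x L → Unique (x ∷ L) → parity (suc (length L)) ≡ true →
                              Σ (Cycle H) λ Z → len Z ≡ suc (length L)
  uniqueOddClosedWalk⇒cycle []                (a ∷ _) _ _  = ⊥-elim (irrefl H a)
  uniqueOddClosedWalk⇒cycle (_ ∷ [])          _       _ ()
  uniqueOddClosedWalk⇒cycle {x} L@(_ ∷ _ ∷ _) w       u _  =
    record { start = x ; rest = L ; long = s≤s (s≤s z≤n) ; unique = u ; closed = w } , refl

  oddClosedWalk⇒oddCycle : ∀ {x} L → ClosedWalk x L → parity (suc (length L)) ≡ true →
                           Σ (Cycle H) λ Z → Odd (len Z) × len Z ≤ suc (length L)
  oddClosedWalk⇒oddCycle L = <-rec OddCycleWithin step (length L) L refl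
    where
    OddCycleWithin : ℕ → Set
    OddCycleWithin k = ∀ {x} L → length L ≡ k → ClosedWalk x L → parity (suc k) ≡ true →
                       Σ (Cycle H) λ Z → Odd (len Z) × len Z ≤ suc k
    step : ∀ k → (∀ {j} → j < k → OddCycleWithin j) → OddCycleWithin k
    step k rec L refl w odd with closedWalk-decompose L w
    ... | inj₁ u with uniqueOddClosedWalk⇒cycle L w u odd
    ...   | Z , lenZ = Z , parity⇒Odd (len Z) (trans (cong parity lenZ) odd) , ≤-reflexive lenZ
    step k rec L refl w odd | inj₂ (y , B , E , wB , wE , split)
      with summands< split | parity-+-odd (suc (length B)) (suc (length E)) (subst (λ t → parity t ≡ true) split odd)
    ... | B<L , _ | inj₁ oddB with rec B<L B refl wB oddB
    ...   | Z , oZ , le = Z , oZ , ≤-trans le (s≤s (<⇒≤ B<L))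
    step k rec L refl w odd | inj₂ (y , B , E , wB , wE , split) | _ , E<L | inj₂ oddE with rec E<L E refl wE oddE
    ...   | Z , oZ , le = Z , oZ , ≤-trans le (s≤s (<⇒≤ E<L))

  closedWalk-nonempty : ∀ {y} Lp → ClosedWalk y Lp → 1 ≤ length Lp
  closedWalk-nonempty []      (yy ∷ _) = ⊥-elim (irrefl H yy)
  closedWalk-nonempty (_ ∷ _) _        = s≤s z≤n

[n∸m]+[m+o∸n]≡o : ∀ m n {o} → m ≤ n → n ≤ m + o → n ∸ m + (m + o ∸ n) ≡ o
[n∸m]+[m+o∸n]≡o m n {o} m≤n n≤m+o = begin
  n ∸ m + (m + o ∸ n)     ≡⟨ +-comm (n ∸ m) _ ⟩
  (m + o ∸ n) + (n ∸ m)   ≡⟨ +-∸-assoc (m + o ∸ n) m≤n ⟨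
  (m + o ∸ n) + n ∸ m     ≡⟨ cong (_∸ m) (m∸n+n≡m n≤m+o) ⟩
  m + o ∸ m               ≡⟨ m+n∸m≡n m o ⟩
  o                       ∎
  where open ≡-Reasoning

module CycleIndexing {n : ℕ} {H : Graph n} (C : Cycle H) where
  open ≡-Reasoning

  g : ℕ
  g = len C

  private
    vs : List (Fin n)
    vs = verts C
    s₀ : Fin n
    s₀ = start C

  %-+ : ∀ t k → (t + k) % g ≡ (t % g + k) % g
  %-+ t k = trans (%-distribˡ-+ t k g)
    (sym (trans (%-distribˡ-+ (t % g) k g) (cong (λ r → (r + k % g) % g) (m%n%n≡m%n t g))))

  cyc≡nth : ∀ t → cyc C t ≡ nth vs (t % g) s₀
  cyc≡nth t = trans (lookup≡nth vs (t mod g) s₀) (cong (λ k → nth vs k s₀) (toℕ-fromℕ< (m%n<n t g)))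

  cyc-lookup : (i : Fin g) → cyc C (toℕ i) ≡ lookup vs i
  cyc-lookup i = trans (cyc≡nth (toℕ i)) (trans (cong (λ k → nth vs k s₀) (m<n⇒m%n≡m (toℕ<n i))) (sym (lookup≡nth vs i s₀)))

  cyc∈ : ∀ t → cyc C t ∈ vs
  cyc∈ t = ∈-lookup (t mod g)

  cyc-%-cong : ∀ {t t′} → t % g ≡ t′ % g → cyc C t ≡ cyc C t′
  cyc-%-cong {t} {t′} e = trans (cyc≡nth t) (trans (cong (λ k → nth vs k s₀) e) (sym (cyc≡nth t′)))

  %-suc : ∀ t → suc t % g ≡ suc (t % g) % g
  %-suc t = trans (cong (_% g) (+-comm 1 t)) (trans (%-+ t 1) (cong (_% g) (+-comm (t % g) 1)))

  cyc≡nthClosedWalk : ∀ t → cyc C t ≡ nth (closedWalk C) (t % g) s₀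
  cyc≡nthClosedWalk t = trans (cyc≡nth t) (sym (nth-++ˡ vs [ s₀ ] s₀ (m%n<n t g)))

  suc<closedWalk : ∀ {k} → k < g → suc k < length (closedWalk C)
  suc<closedWalk {k} k<g = subst (suc k <_) (sym (trans (length-++ vs) (+-comm g 1))) (s≤s k<g)

  cyc-consecutive : ∀ t → Σ ℕ λ k → suc k < length (closedWalk C) ×
    cyc C t ≡ nth (closedWalk C) k s₀ × cyc C (suc t) ≡ nth (closedWalk C) (suc k) s₀
  cyc-consecutive t with suc (t % g) <? g
  ... | yes sk<g = t % g , suc<closedWalk (m%n<n t g) , cyc≡nthClosedWalk t , (begin
        cyc C (suc t)                                   ≡⟨ cyc≡nth (suc t) ⟩
        nth vs (suc t % g) s₀                            ≡⟨ cong (λ m → nth vs m s₀) (trans (%-suc t) (m<n⇒m%n≡m sk<g)) ⟩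
        nth vs (suc (t % g)) s₀                          ≡⟨ nth-++ˡ vs [ s₀ ] s₀ sk<g ⟨
        nth (closedWalk C) (suc (t % g)) s₀              ∎)
  ... | no sk≮g = t % g , suc<closedWalk (m%n<n t g) , cyc≡nthClosedWalk t , (begin
        cyc C (suc t)                        ≡⟨ cyc≡nth (suc t) ⟩
        nth vs (suc t % g) s₀                 ≡⟨ cong (λ m → nth vs m s₀) (trans (%-suc t) (trans (cong (_% g) sk≡g) (n%n≡0 g))) ⟩
        s₀                                    ≡⟨ nth-++ʳ vs [ s₀ ] 0 s₀ ⟨
        nth (closedWalk C) (g + 0) s₀         ≡⟨ cong (λ m → nth (closedWalk C) m s₀) (trans (+-identityʳ g) (sym sk≡g)) ⟩
        nth (closedWalk C) (suc (t % g)) s₀   ∎)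
    where
    sk≡g : suc (t % g) ≡ g
    sk≡g = ≤-antisym (m%n<n t g) (≮⇒≥ sk≮g)

  cyc-adj : ∀ t → Adj H (cyc C t) (cyc C (suc t))
  cyc-adj t with cyc-consecutive t
  ... | k , k< , e₁ , e₂ = subst₂ (Adj H) (sym e₁) (sym e₂) (linked-nth (closedWalk C) s₀ (closed C) k<)

  cyc-edge : ∀ t → EdgeOf H C (cyc C t) (cyc C (suc t))
  cyc-edge t with cyc-consecutive t
  ... | k , k< , e₁ , e₂ = subst₂ (λ a b → EdgeOn a b (closedWalk C)) (sym e₁) (sym e₂) (EdgeOn-nth (closedWalk C) s₀ k<)

  %-shift≢ : ∀ t {k} → 0 < k → k < g → (t + k) % g ≢ t % g
  %-shift≢ t {k} 0<k k<g e with t % g + k <? g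
  ... | yes r+k<g = <⇒≢ (m<m+n (t % g) 0<k) (sym (trans (sym (m<n⇒m%n≡m r+k<g)) (trans (sym (%-+ t k)) e)))
  ... | no r+k≮g = <⇒≢ k<g (sym g≡k)
    where
    r : ℕ
    r = t % g
    g≤r+k : g ≤ r + k
    g≤r+k = ≮⇒≥ r+k≮g
    r+k∸g<g : r + k ∸ g < g
    r+k∸g<g = +-cancelʳ-< g _ _ (subst (_< g + g) (sym (m∸n+n≡m g≤r+k)) (+-mono-< (m%n<n t g) k<g))
    r+k∸g≡r : r + k ∸ g ≡ r
    r+k∸g≡r = trans (sym (m<n⇒m%n≡m r+k∸g<g)) (trans (m≤n⇒[n∸m]%m≡n%m g≤r+k) (trans (sym (%-+ t k)) e))
    g≡k : g ≡ k
    g≡k = +-cancelˡ-≡ r g k (trans (trans (+-comm r g) (cong (g +_) (sym r+k∸g≡r))) (m+[n∸m]≡n g≤r+k))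

  cyc-injective : ∀ a {i j} → i < j → j < g → cyc C (a + i) ≢ cyc C (a + j)
  cyc-injective a {i} {j} i<j j<g e = %-shift≢ (a + i) (m<n⇒0<n∸m i<j) (≤-<-trans (m∸n≤m j i) j<g) (sym same%)
    where
    a+j≡ : a + i + (j ∸ i) ≡ a + j
    a+j≡ = trans (+-assoc a i (j ∸ i)) (cong (a +_) (m+[n∸m]≡n (<⇒≤ i<j)))
    same% : (a + i) % g ≡ (a + i + (j ∸ i)) % g
    same% = trans (nth-injective vs s₀ (unique C) (m%n<n (a + i) g) (m%n<n (a + j) g)
                     (trans (sym (cyc≡nth (a + i))) (trans e (cyc≡nth (a + j)))))
                  (cong (_% g) (sym a+j≡))

  private
    D : Fin g → Fin g → ℕ
    D = dist H C

  dist-≤ : (a b : Fin g) → toℕ a ≤ toℕ b → D a b ≡ toℕ b ∸ toℕ a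
  dist-≤ a b a≤b = begin
    (toℕ b + g ∸ toℕ a) % g   ≡⟨ cong (_% g) (+-∸-comm g a≤b) ⟩
    (toℕ b ∸ toℕ a + g) % g   ≡⟨ [m+n]%n≡m%n (toℕ b ∸ toℕ a) g ⟩
    (toℕ b ∸ toℕ a) % g       ≡⟨ m<n⇒m%n≡m (≤-<-trans (m∸n≤m (toℕ b) (toℕ a)) (toℕ<n b)) ⟩
    toℕ b ∸ toℕ a             ∎

  dist-> : (a b : Fin g) → toℕ b < toℕ a → D a b ≡ toℕ b + g ∸ toℕ a
  dist-> a b b<a = m<n⇒m%n≡m (+-cancelʳ-< (toℕ a) _ _
    (subst (_< g + toℕ a) (sym (m∸n+n≡m a≤b+g)) (subst (_< g + toℕ a) (+-comm g (toℕ b)) (+-monoʳ-< g b<a))))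
    where
    a≤b+g : toℕ a ≤ toℕ b + g
    a≤b+g = ≤-trans (<⇒≤ (toℕ<n a)) (m≤n+m g (toℕ b))

  dist<len : (a b : Fin g) → D a b < g
  dist<len a b = m%n<n (toℕ b + g ∸ toℕ a) g

  dist>0 : (a b : Fin g) → a ≢ b → 0 < D a b
  dist>0 a b a≢b with toℕ a ≤? toℕ b
  ... | yes a≤b rewrite dist-≤ a b a≤b = m<n⇒0<n∸m (≤∧≢⇒< a≤b (a≢b ∘ toℕ-injective))
  ... | no a≰b  rewrite dist-> a b (≰⇒> a≰b) = m<n⇒0<n∸m (≤-trans (toℕ<n a) (m≤n+m g (toℕ b)))

  dist+dist : (a b : Fin g) → a ≢ b → D a b + D b a ≡ g
  dist+dist a b a≢b with <-cmp (toℕ a) (toℕ b)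
  ... | tri≈ _ a≡b _ = ⊥-elim (a≢b (toℕ-injective a≡b))
  ... | tri< a<b _ _ rewrite dist-≤ a b (<⇒≤ a<b) | dist-> b a a<b = [n∸m]+[m+o∸n]≡o (toℕ a) (toℕ b) (<⇒≤ a<b) (≤-trans (<⇒≤ (toℕ<n b)) (m≤n+m g (toℕ a)))
  ... | tri> _ _ b<a rewrite dist-> a b b<a | dist-≤ b a (<⇒≤ b<a) =
    trans (+-comm (toℕ b + g ∸ toℕ a) (toℕ a ∸ toℕ b)) ([n∸m]+[m+o∸n]≡o (toℕ b) (toℕ a) (<⇒≤ b<a) (≤-trans (<⇒≤ (toℕ<n a)) (m≤n+m g (toℕ b))))

  dist-end : (a b : Fin g) → cyc C (toℕ a + D a b) ≡ lookup vs b
  dist-end a b with toℕ a ≤? toℕ b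
  ... | yes a≤b rewrite dist-≤ a b a≤b | m+[n∸m]≡n a≤b = cyc-lookup b
  ... | no a≰b  rewrite dist-> a b (≰⇒> a≰b) =
    trans (cong (cyc C) (m+[n∸m]≡n (≤-trans (<⇒≤ (toℕ<n a)) (m≤n+m g (toℕ b)))))
          (trans (cyc-%-cong {toℕ b + g} {toℕ b} ([m+n]%n≡m%n (toℕ b) g)) (cyc-lookup b))

  segment : ℕ → ℕ → List (Fin n)
  segment a m = applyUpTo (λ t → cyc C (a + t)) m

  segment-linked : ∀ a m → Linked (Adj H) (segment a m)
  segment-linked a m = Linked.applyUpTo⁺₂ _ m λ t → subst (Adj H (cyc C (a + t)) ∘ cyc C) (sym (+-suc a t)) (cyc-adj (a + t))

  segment-unique : ∀ a {m} → m ≤ g → Unique (segment a m)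
  segment-unique a m≤g = Unique.applyUpTo⁺₁ _ _ λ i<j j<m → cyc-injective a i<j (≤-trans j<m m≤g)

  arcWalk≡segment : (a b : Fin g) → a ≢ b →
                    lookup vs a ∷ arcInterior H C a b ++ [ lookup vs b ] ≡ segment (toℕ a) (suc (D a b))
  arcWalk≡segment a b a≢b with D a b | dist>0 a b a≢b | dist-end a b
  ... | suc d | _ | end = cong₂ _∷_ (trans (sym (cyc-lookup a)) (cong (cyc C) (sym (+-identityʳ (toℕ a)))))
    (begin
      map (λ t → cyc C (toℕ a + suc t)) (upTo d) ++ [ lookup vs b ]     ≡⟨ cong₂ (λ xs x → xs ++ [ x ]) (map-upTo _ d) (sym end) ⟩
      applyUpTo (λ t → cyc C (toℕ a + suc t)) d ++ [ cyc C (toℕ a + suc d) ] ≡⟨ applyUpTo-∷ʳ _ d ⟩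
      applyUpTo (λ t → cyc C (toℕ a + suc t)) (suc d)                   ∎)

  arcWalk-linked : (a b : Fin g) → a ≢ b → Linked (Adj H) (lookup vs a ∷ arcInterior H C a b ++ [ lookup vs b ])
  arcWalk-linked a b a≢b = subst (Linked (Adj H)) (sym (arcWalk≡segment a b a≢b)) (segment-linked (toℕ a) _)

  arcWalk-unique : (a b : Fin g) → a ≢ b → Unique (lookup vs a ∷ arcInterior H C a b ++ [ lookup vs b ])
  arcWalk-unique a b a≢b = subst Unique (sym (arcWalk≡segment a b a≢b)) (segment-unique (toℕ a) (dist<len a b))

  length-arcWalk : (a b : Fin g) → a ≢ b → suc (length (arcInterior H C a b)) ≡ D a b
  length-arcWalk a b a≢b with D a b | dist>0 a b a≢b
  ... | suc d | _ = cong suc (trans (length-map _ (upTo d)) (length-upTo d))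

  arcInterior⊆C : (a b : Fin g) → ∀ {v} → v ∈ arcInterior H C a b → v ∈ vs
  arcInterior⊆C a b v∈ with ∈-map⁻ _ v∈
  ... | t , _ , refl = cyc∈ (toℕ a + suc t)

-- Ears of a shortest odd cycle

module Ears {n : ℕ} {H : Graph n} {C : Cycle H} (shortest : ShortestOddCycle H C) where
  open CycleIndexing C

  private
    V : Set
    V = Fin n
    vs : List V
    vs = verts C

  len≤oddClosedWalk : ∀ {x} L → ClosedWalk H x L → parity (suc (length L)) ≡ true → g ≤ suc (length L)
  len≤oddClosedWalk L w odd with oddClosedWalk⇒oddCycle H L w odd
  ... | Z , oddZ , Z≤ = ≤-trans (proj₂ shortest Z oddZ) Z≤

  ∈C⇒lookup : ∀ {v} → v ∈ vs → Σ (Fin g) λ a → v ≡ lookup vs a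
  ∈C⇒lookup v∈ = index v∈ , lookup-index v∈

  dist≡1⇒edge : (a b : Fin g) → dist H C a b ≡ 1 → EdgeOf H C (lookup vs a) (lookup vs b)
  dist≡1⇒edge a b d≡1 = subst₂ (EdgeOf H C) (cyc-lookup a)
    (trans (cong (cyc C) (trans (+-comm 1 (toℕ a)) (cong (toℕ a +_) (sym d≡1)))) (dist-end a b)) (cyc-edge (toℕ a))

  arc+edge : (a b : Fin g) → a ≢ b → Adj H (lookup vs b) (lookup vs a) →
             ClosedWalk H (lookup vs a) (arcInterior H C a b ++ [ lookup vs b ])
  arc+edge a b a≢b ba = linked-snoc (lookup vs a ∷ arcInterior H C a b) (arcWalk-linked a b a≢b) ba

  arc+edge-length : (a b : Fin g) → a ≢ b → suc (length (arcInterior H C a b ++ [ lookup vs b ])) ≡ dist H C a b + 1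
  arc+edge-length a b a≢b = trans (cong suc (length-++ (arcInterior H C a b))) (cong (_+ 1) (length-arcWalk a b a≢b))

  private
    arc-long : (a b : Fin g) → a ≢ b → Adj H (lookup vs b) (lookup vs a) → parity (dist H C a b + 1) ≡ true → g ≤ dist H C a b + 1
    arc-long a b a≢b ba odd = subst (g ≤_) (arc+edge-length a b a≢b)
      (len≤oddClosedWalk _ (arc+edge a b a≢b ba) (subst (λ m → parity m ≡ true) (sym (arc+edge-length a b a≢b)) odd))

    arc≡1 : ∀ {d d′} → d + d′ ≡ g → 0 < d′ → g ≤ d + 1 → d′ ≡ 1
    arc≡1 {d} {d′} d+d′≡g 0<d′ g≤d+1 = ≤-antisym (+-cancelˡ-≤ d d′ 1 (subst (_≤ d + 1) (sym d+d′≡g) g≤d+1)) 0<d′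

  -- The chord closes two cycles with the two arcs of C; their lengths add up to |C| + 2, so one of them is odd,
  -- hence at least |C| long, which leaves a single edge for the other arc.
  chord⇒edge : (a b : Fin g) → a ≢ b → Adj H (lookup vs a) (lookup vs b) → EdgeOf H C (lookup vs a) (lookup vs b)
  chord⇒edge a b a≢b ab with parity-+-odd (D a b + 1) (D b a + 1) total-odd
    where
    D : Fin g → Fin g → ℕ
    D = dist H C
    shuffle : ∀ x y → (x + 1) + (y + 1) ≡ (x + y) + 2
    shuffle = solve-∀
    total-odd : parity ((D a b + 1) + (D b a + 1)) ≡ true
    total-odd = trans (cong parity (trans (shuffle (D a b) (D b a)) (cong (_+ 2) (dist+dist a b a≢b))))
                      (trans (parity-+2 g) (Odd⇒parity g (proj₁ shortest)))
  ... | inj₁ odd-ab = EdgeOn-sym (dist≡1⇒edge b a (arc≡1 (dist+dist a b a≢b) (dist>0 b a (a≢b ∘ sym)) (arc-long a b a≢b (Graph.sym H ab) odd-ab)))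
  ... | inj₂ odd-ba = dist≡1⇒edge a b (arc≡1 (dist+dist b a (a≢b ∘ sym)) (dist>0 a b a≢b) (arc-long b a (a≢b ∘ sym) ab odd-ba))

  adjacentOnC⇒edge : ∀ {w y} → w ∈ vs → y ∈ vs → Adj H w y → EdgeOf H C w y
  adjacentOnC⇒edge w∈ y∈ wy with ∈C⇒lookup w∈ | ∈C⇒lookup y∈
  ... | a , refl | b , refl = chord⇒edge a b (λ { refl → irrefl H wy }) wy

  first∈C : (Q : Ear H C) → first Q ∈ vs
  first∈C Q = subst (_∈ vs) (sym (first≡ Q)) (∈-lookup (i Q))

  final∈C : (Q : Ear H C) → final Q ∈ vs
  final∈C Q = subst (_∈ vs) (sym (final≡ Q)) (∈-lookup (j Q))

  i≢j : (Q : Ear H C) → i Q ≢ j Q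
  i≢j Q i≡j = proj₁ (unique-∷⁻ (uniqueQ Q))
    (subst (_∈ interior Q ++ [ final Q ]) (trans (final≡ Q) (trans (cong (lookup vs) (sym i≡j)) (sym (first≡ Q))))
      (∈-++⁺ʳ (interior Q) (here refl)))

  record ClosingArc (Q : Ear H C) (K : List V) : Set where
    field
      arc-linked : Linked (Adj H) (final Q ∷ K ++ [ first Q ])
      arc-unique : Unique (final Q ∷ K ++ [ first Q ])
      arc⊆C      : ∀ {v} → v ∈ K → v ∈ vs
  open ClosingArc public

  closingArc : (Q : Ear H C) (K : List V) → Linked (Adj H) (lookup vs (j Q) ∷ K ++ [ lookup vs (i Q) ]) →
               Unique (lookup vs (j Q) ∷ K ++ [ lookup vs (i Q) ]) → (∀ {v} → v ∈ K → v ∈ vs) → ClosingArc Q K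
  closingArc Q K l u K⊆C = record
    { arc-linked = subst₂ (λ a b → Linked (Adj H) (a ∷ K ++ [ b ])) (sym (final≡ Q)) (sym (first≡ Q)) l
    ; arc-unique = subst₂ (λ a b → Unique (a ∷ K ++ [ b ])) (sym (final≡ Q)) (sym (first≡ Q)) u
    ; arc⊆C      = K⊆C }

  closingArc₁ : (Q : Ear H C) → ClosingArc Q (arcInterior H C (j Q) (i Q))
  closingArc₁ Q = closingArc Q _ (arcWalk-linked (j Q) (i Q) (i≢j Q ∘ sym)) (arcWalk-unique (j Q) (i Q) (i≢j Q ∘ sym)) (arcInterior⊆C (j Q) (i Q))

  closingArc₂ : (Q : Ear H C) → ClosingArc Q (reverse (arcInterior H C (i Q) (j Q)))
  closingArc₂ Q = closingArc Q _
    (subst (Linked (Adj H)) (reverse-∷-++ _ X _) (linked-reverse⁺ (Graph.sym H) (arcWalk-linked (i Q) (j Q) (i≢j Q))))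
    (subst Unique (reverse-∷-++ _ X _) (unique-reverse⁺ (arcWalk-unique (i Q) (j Q) (i≢j Q))))
    (arcInterior⊆C (i Q) (j Q) ∘ reverse⁻)
    where
    X : List V
    X = arcInterior H C (i Q) (j Q)

  module Arcs (Q : Ear H C) where
    K₁ K₂ : List V
    K₁ = arcInterior H C (j Q) (i Q)
    K₂ = reverse (arcInterior H C (i Q) (j Q))

    arcs₁₂ : suc (length K₁) + suc (length K₂) ≡ g
    arcs₁₂ = trans (cong₂ _+_ (length-arcWalk (j Q) (i Q) (i≢j Q ∘ sym))
                              (trans (cong suc (length-reverse (arcInterior H C (i Q) (j Q)))) (length-arcWalk (i Q) (j Q) (i≢j Q))))
                   (dist+dist (j Q) (i Q) (i≢j Q ∘ sym))

  private
    chosen : ∀ {Q : Ear H C} {b} → (length (earCycle₁ H C Q) % 2 ≡ᵇ 1) ≡ b → 𝔠 H C Q ≡ (if b then earCycle₁ H C Q else earCycle₂ H C Q)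
    chosen = cong (λ b → if b then _ else _)

  -- 𝔠 Q closes Q along the arc K; K′ is the other arc of C between the ends of Q
  record Closures (Q : Ear H C) : Set where
    field
      K K′  : List V
      𝔠≡    : 𝔠 H C Q ≡ earVerts Q ++ K
      arc   : ClosingArc Q K
      arc′  : ClosingArc Q K′
      arcs  : suc (length K) + suc (length K′) ≡ g
      𝔠-parity : parity (length (𝔠 H C Q)) ≡ true

  closures : (Q : Ear H C) → Closures Q
  closures Q with length (earCycle₁ H C Q) % 2 ≡ᵇ 1 in odd₁
  ... | true  = record { K = K₁ ; K′ = K₂ ; 𝔠≡ = chosen {Q} odd₁ ; arc = closingArc₁ Q ; arc′ = closingArc₂ Q ; arcs = arcs₁₂
                       ; 𝔠-parity = trans (cong (parity ∘ length) (chosen {Q} odd₁)) (trans (sym (odd?≡parity (length (earCycle₁ H C Q)))) odd₁) }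
    where open Arcs Q
  ... | false = record { K = K₂ ; K′ = K₁ ; 𝔠≡ = chosen {Q} odd₁ ; arc = closingArc₂ Q ; arc′ = closingArc₁ Q
                       ; arcs = trans (+-comm (suc (length K₂)) _) arcs₁₂
                       ; 𝔠-parity = trans (cong (parity ∘ length) (chosen {Q} odd₁)) odd₂ }
    where
    open Arcs Q
    E : ℕ
    E = length (earVerts Q)
    even₁ : parity (E + length K₁) ≡ false
    even₁ = trans (cong parity (sym (length-++ (earVerts Q) {K₁}))) (trans (sym (odd?≡parity (length (earCycle₁ H C Q)))) odd₁)
    odd₁₂ : parity (length K₁ + length K₂) ≡ true
    odd₁₂ = trans (sym (parity-suc-suc (length K₁ + length K₂))) (trans (cong parity (sym (+-suc (suc (length K₁)) (length K₂))))
              (trans (cong parity arcs₁₂) (Odd⇒parity g (proj₁ shortest))))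
    odd₂ : parity (length (earVerts Q ++ K₂)) ≡ true
    odd₂ = trans (cong parity (length-++ (earVerts Q) {K₂})) (trans (parity-even⇒swap E (length K₁) (length K₂) even₁) odd₁₂)

  𝔠-odd : (Q : Ear H C) → Odd (length (𝔠 H C Q))
  𝔠-odd Q = parity⇒Odd (length (𝔠 H C Q)) (Closures.𝔠-parity (closures Q))

  earVerts-++ : (Q : Ear H C) (K : List V) → earVerts Q ++ K ≡ first Q ∷ interior Q ++ final Q ∷ K
  earVerts-++ Q K = cong (first Q ∷_) (++-assoc (interior Q) [ final Q ] K)

  closure-linked : ∀ {Q K} → ClosingArc Q K → Linked (Adj H) (earVerts Q ++ K ++ [ first Q ])
  closure-linked {Q} {K} a = subst (Linked (Adj H)) (sym (earVerts-++ Q (K ++ [ first Q ])))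
    (linked-join (first Q ∷ interior Q) (path Q) (arc-linked a))

  closure-unique : ∀ {Q K} → ClosingArc Q K → Unique (earVerts Q ++ K)
  closure-unique {Q} {K} a with unique-∷⁻ (arc-unique a)
  ... | final∉ , uK-first with unique-++⁻ K uK-first
  ...   | uK , _ , first∉ = unique-++⁺ (earVerts Q) (uniqueQ Q) uK disjoint
    where
    disjoint : ∀ {v} → v ∈ earVerts Q → v ∉ K
    disjoint (here refl) v∈K = first∉ v∈K (here refl)
    disjoint (there v∈) v∈K with ∈-++⁻ (interior Q) v∈
    ... | inj₁ v∈int        = All.lookup (offC Q) v∈int (arc⊆C a v∈K)
    ... | inj₂ (here refl) = final∉ (∈-++⁺ˡ v∈K)

  𝔠-cycle : (Q : Ear H C) → Σ (Cycle H) λ Z → len Z ≡ length (𝔠 H C Q)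
  𝔠-cycle Q = Z , cong length (sym 𝔠≡)
    where
    open Closures (closures Q)
    Z : Cycle H
    Z = record
      { start  = first Q
      ; rest   = (interior Q ++ [ final Q ]) ++ K
      ; long   = ≤-trans (subst (2 ≤_) (sym (length-++ (interior Q))) (+-mono-≤ (nonTriv Q) (s≤s z≤n)))
                         (subst (length (interior Q ++ [ final Q ]) ≤_) (sym (length-++ (interior Q ++ [ final Q ]))) (m≤m+n _ _))
      ; unique = closure-unique arc
      ; closed = subst (λ t → Linked (Adj H) (first Q ∷ t)) (sym (++-assoc (interior Q ++ [ final Q ]) K [ first Q ])) (closure-linked arc) }

  -- the other arc K′, reversed, closes T to a closed walk of odd length, which is therefore at least |C| long
  𝔠-minimal : (Q : Ear H C) (T : List V) → Linked (Adj H) (earVerts Q ++ T ++ [ first Q ]) →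
              parity (length (earVerts Q) + length T) ≡ true → length (𝔠 H C Q) ≤ length (earVerts Q) + length T
  𝔠-minimal Q T closure odd-T = subst (_≤ E + length T) (sym 𝔠-length) (+-monoʳ-≤ E K≤T)
    where
    open Closures (closures Q)
    E : ℕ
    E = length (earVerts Q)
    𝔠-length : length (𝔠 H C Q) ≡ E + length K
    𝔠-length = trans (cong length 𝔠≡) (length-++ (earVerts Q))
    back : Linked (Adj H) (final Q ∷ T ++ [ first Q ])
    back = linked-++⁻ʳ (first Q ∷ interior Q) (subst (Linked (Adj H)) (earVerts-++ Q (T ++ [ first Q ])) closure)
    forth : Linked (Adj H) (first Q ∷ reverse K′ ++ [ final Q ])
    forth = subst (Linked (Adj H)) (reverse-∷-++ _ K′ _) (linked-reverse⁺ (Graph.sym H) (arc-linked arc′))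
    loop : ClosedWalk H (final Q) (T ++ first Q ∷ reverse K′)
    loop = subst (λ t → Linked (Adj H) (final Q ∷ t)) (sym (++-assoc T (first Q ∷ reverse K′) [ final Q ]))
             (linked-join (final Q ∷ T) back forth)
    loop-length : suc (length (T ++ first Q ∷ reverse K′)) ≡ suc (length T) + suc (length K′)
    loop-length = cong suc (trans (length-++ T) (cong (λ m → length T + suc m) (length-reverse K′)))
    loop-odd : parity (suc (length T) + suc (length K′)) ≡ true
    loop-odd = trans (cong not (parity-cancelˡ E (length T) (length K) (trans odd-T (sym odd-K)) (suc (length K′))))
                     (trans (cong parity arcs) (Odd⇒parity g (proj₁ shortest)))
      where
      odd-K : parity (E + length K) ≡ true
      odd-K = trans (cong parity (sym 𝔠-length)) 𝔠-parity
    K≤T : length K ≤ length T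
    K≤T = ≤-pred (+-cancelʳ-≤ (suc (length K′)) _ _
            (subst (_≤ suc (length T) + suc (length K′)) (sym arcs)
              (subst (g ≤_) loop-length (len≤oddClosedWalk _ loop (subst (λ m → parity m ≡ true) (sym loop-length) loop-odd)))))

  𝔠-short : (Q : Ear H C) → suc (suc (length (𝔠 H C Q))) ≤ length (earVerts Q) + g
  𝔠-short Q = begin
    suc (suc (length (𝔠 H C Q)))            ≡⟨ cong (suc ∘ suc) (trans (cong length 𝔠≡) (length-++ (earVerts Q))) ⟩
    suc (suc (E + k))                       ≡⟨ sym (trans (+-suc E (suc k)) (cong suc (+-suc E k))) ⟩
    E + suc (suc k)                         ≤⟨ +-monoʳ-≤ E (subst (_≤ suc k + suc (length K′)) (+-comm (suc k) 1) (+-monoʳ-≤ (suc k) (s≤s z≤n))) ⟩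
    E + (suc k + suc (length K′))           ≡⟨ cong (E +_) arcs ⟩
    E + g                                   ∎
    where
    open Closures (closures Q)
    open ≤-Reasoning
    E k : ℕ
    E = length (earVerts Q)
    k = length K

  𝔠≤closure : ∀ {m} (Q : Ear H C) (T : List V) → Linked (Adj H) (earVerts Q ++ T ++ [ first Q ]) →
              length (earVerts Q) + length T ≡ m → parity m ≡ true → length (𝔠 H C Q) ≤ m
  𝔠≤closure Q T closure refl odd = 𝔠-minimal Q T closure odd

  -- either the closure through T or the loop is odd: the first case is 𝔠-minimal, the second bounds |C| by the loop
  𝔠≤closure+loop : ∀ {c m} (Q : Ear H C) (T : List V) {y} (Lp : List V) →
    Linked (Adj H) (earVerts Q ++ T ++ [ first Q ]) → ClosedWalk H y Lp →
    length (earVerts Q) + length T + suc (length Lp) ≡ m → parity m ≡ true → m ≤ c + 2 → length (𝔠 H C Q) ≤ c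
  𝔠≤closure+loop {c} Q T Lp closure loop refl odd m≤c+2 with parity-+-odd (length (earVerts Q) + length T) (suc (length Lp)) odd
  ... | inj₁ odd-T = ≤-trans (𝔠-minimal Q T closure odd-T) (+-cancelʳ-≤ 2 _ _ (begin
          E + length T + 2                      ≤⟨ +-monoʳ-≤ (E + length T) (s≤s (closedWalk-nonempty H Lp loop)) ⟩
          E + length T + suc (length Lp)        ≤⟨ m≤c+2 ⟩
          c + 2                                 ∎))
    where
    open ≤-Reasoning
    E : ℕ
    E = length (earVerts Q)
  ... | inj₂ odd-L = +-cancelʳ-≤ 2 _ _ (begin
          length (𝔠 H C Q) + 2                  ≡⟨ +-comm _ 2 ⟩
          suc (suc (length (𝔠 H C Q)))          ≤⟨ 𝔠-short Q ⟩
          E + g                                 ≤⟨ +-monoʳ-≤ E (len≤oddClosedWalk Lp loop odd-L) ⟩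
          E + suc (length Lp)                   ≤⟨ +-monoˡ-≤ (suc (length Lp)) (m≤m+n E (length T)) ⟩
          E + length T + suc (length Lp)        ≤⟨ m≤c+2 ⟩
          c + 2                                 ∎)
    where
    open ≤-Reasoning
    E : ℕ
    E = length (earVerts Q)

  reverseEar : Ear H C → Ear H C
  reverseEar Q = record
    { first    = final Q
    ; interior = reverse (interior Q)
    ; final    = first Q
    ; nonTriv  = subst (1 ≤_) (sym (length-reverse (interior Q))) (nonTriv Q)
    ; uniqueQ  = subst Unique (reverse-∷-++ _ (interior Q) _) (unique-reverse⁺ (uniqueQ Q))
    ; path     = subst (Linked (Adj H)) (reverse-∷-++ _ (interior Q) _) (linked-reverse⁺ (Graph.sym H) (path Q))
    ; i        = j Q
    ; j        = i Q
    ; first≡   = final≡ Q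
    ; final≡   = first≡ Q
    ; offC     = All.tabulate (All.lookup (offC Q) ∘ reverse⁻) }

  𝔠-reverseEar≤ : (Q : Ear H C) → length (𝔠 H C (reverseEar Q)) ≤ length (𝔠 H C Q)
  𝔠-reverseEar≤ Q = 𝔠≤closure (reverseEar Q) (reverse K) closure lengths 𝔠-parity
    where
    open Closures (closures Q)
    back : Linked (Adj H) (first Q ∷ reverse K ++ [ final Q ])
    back = subst (Linked (Adj H)) (reverse-∷-++ _ K _) (linked-reverse⁺ (Graph.sym H) (arc-linked arc))
    closure : Linked (Adj H) (earVerts (reverseEar Q) ++ reverse K ++ [ first (reverseEar Q) ])
    closure = subst (Linked (Adj H)) (sym (earVerts-++ (reverseEar Q) (reverse K ++ [ final Q ])))
               (linked-join (final Q ∷ reverse (interior Q)) (path (reverseEar Q)) back)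
    lengths : length (earVerts (reverseEar Q)) + length (reverse K) ≡ length (𝔠 H C Q)
    lengths = trans (cong₂ _+_ (trans (cong length (sym (reverse-∷-++ _ (interior Q) _))) (length-reverse (earVerts Q))) (length-reverse K))
                    (trans (sym (length-++ (earVerts Q))) (cong length (sym 𝔠≡)))

  -- no length hypothesis is needed: a single edge between two vertices of C would be an edge of C (adjacentOnC⇒edge)
  earThrough : ∀ {s t a b} (L : List V) → StartsWith s L → EndsWith t L → Unique L → Linked (Adj H) L →
               s ∈ vs → t ∈ vs → (∀ {v} → v ∈ L → v ∈ vs → v ≡ s ⊎ v ≡ t) →
               EdgeOn a b L → ¬ EdgeOf H C a b → Σ (Ear H C) λ Q → earVerts Q ≡ L × first Q ≡ s
  earThrough L starts ends u l s∈ t∈ ends-only ab ab∉C with startsEnds⇒sandwich starts ends (EdgeOn⇒2≤length ab)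
  earThrough {a = a} {b} .(_ ∷ [ _ ]) _ _ u (st ∷ [-]) s∈ t∈ _ ab ab∉C | [] , refl = ⊥-elim (ab∉C (onlyEdge ab))
    where
    onlyEdge : EdgeOn a b (_ ∷ [ _ ]) → EdgeOf H C a b
    onlyEdge here-ab = adjacentOnC⇒edge s∈ t∈ st
    onlyEdge here-ba = EdgeOn-sym (adjacentOnC⇒edge s∈ t∈ st)
    onlyEdge (there (there ()))
  earThrough {s} {t} .(_ ∷ M ++ [ _ ]) _ _ u l s∈ t∈ ends-only _ _ | M@(_ ∷ _) , refl = Q , refl , refl
    where
    notEnd : ∀ {v} → v ∈ M → ¬ (v ≡ s ⊎ v ≡ t)
    notEnd v∈M (inj₁ refl) = proj₁ (unique-∷⁻ u) (∈-++⁺ˡ v∈M)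
    notEnd v∈M (inj₂ refl) = proj₂ (proj₂ (unique-++⁻ M (proj₂ (unique-∷⁻ u)))) v∈M (here refl)
    offC′ : All (_∉ vs) M
    offC′ = All.tabulate λ v∈M v∈C → notEnd v∈M (ends-only (there (∈-++⁺ˡ v∈M)) v∈C)
    Q : Ear H C
    Q = record
      { first = s ; interior = M ; final = t ; nonTriv = s≤s z≤n ; uniqueQ = u ; path = l
      ; i = proj₁ (∈C⇒lookup s∈) ; j = proj₁ (∈C⇒lookup t∈) ; first≡ = proj₂ (∈C⇒lookup s∈) ; final≡ = proj₂ (∈C⇒lookup t∈)
      ; offC = offC′ }

  earVerts∩C : (Q : Ear H C) → ∀ {v} → v ∈ earVerts Q → v ∈ vs → v ≡ first Q ⊎ v ≡ final Q
  earVerts∩C Q (here refl) _ = inj₁ refl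
  earVerts∩C Q (there v∈) v∈C with ∈-++⁻ (interior Q) v∈
  ... | inj₁ v∈int       = ⊥-elim (All.lookup (offC Q) v∈int v∈C)
  ... | inj₂ (here refl) = inj₂ refl

-- Rerouting an ear through a 4-cycle

module Detour {n : ℕ} {H : Graph n} {C : Cycle H} (shortest : ShortestOddCycle H C)
  (Q₁ : Ear H C) (A B : List (Fin n)) {x w y z : Fin n} (split : earVerts Q₁ ≡ A ++ x ∷ w ∷ B)
  (xw : Adj H x w) (wy : Adj H w y) (yz : Adj H y z) (zx : Adj H z x) (w≢z : w ≢ z) (wy∉C : ¬ EdgeOf H C w y) where

  open Ears {C = C} shortest
  open import Data.List.Membership.DecPropositional (_≟_ {n}) using (_∈?_)
  open Closures (closures Q₁)

  private
    V : Set
    V = Fin n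
    vs : List V
    vs = verts C
    sym-adj : ∀ {a b} → Adj H a b → Adj H b a
    sym-adj = Graph.sym H

  u v : V
  u = first Q₁
  v = final Q₁

  P R : List V
  P = A ++ [ x ]
  R = w ∷ B

  Q₁≡P++R : earVerts Q₁ ≡ P ++ R
  Q₁≡P++R = trans split (sym (++-assoc A [ x ] R))

  c : ℕ
  c = length (𝔠 H C Q₁)

  c≡ : c ≡ length P + length R + length K
  c≡ = trans (cong length 𝔠≡) (trans (length-++ (earVerts Q₁)) (cong (_+ length K) (trans (cong length Q₁≡P++R) (length-++ P))))

  c+2-odd : parity (c + 2) ≡ true
  c+2-odd = trans (parity-+2 c) 𝔠-parity

  c+4-odd : parity (c + 4) ≡ true
  c+4-odd = trans (cong parity (sym (+-assoc c 2 2))) (trans (parity-+2 (c + 2)) c+2-odd)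

  closure₁ : Linked (Adj H) (P ++ R ++ K ++ [ u ])
  closure₁ = subst (Linked (Adj H)) (trans (cong (_++ K ++ [ u ]) Q₁≡P++R) (++-assoc P R (K ++ [ u ]))) (closure-linked arc)

  Pw-linked : Linked (Adj H) (P ++ [ w ])
  Pw-linked = linked-prefix P closure₁

  RKu-linked : Linked (Adj H) (R ++ K ++ [ u ])
  RKu-linked = linked-++⁻ʳ P closure₁

  PR-unique : Unique (P ++ R)
  PR-unique = subst Unique Q₁≡P++R (uniqueQ Q₁)

  P∩R : ∀ {a} → a ∈ P → a ∉ R
  P∩R = proj₂ (proj₂ (unique-++⁻ P PR-unique))

  startsP : StartsWith u P
  startsP = startsWith-splice A (subst (StartsWith u) split (_ , refl))

  endsR : EndsWith v R
  endsR = endsWith-suffix [ x ] (endsWith-suffix A (subst (EndsWith v) split (u ∷ interior Q₁ , refl)))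

  onQ₁⇒end : ∀ {a} → a ∈ P ++ R → a ∈ vs → a ≡ u ⊎ a ≡ v
  onQ₁⇒end a∈ = earVerts∩C Q₁ (subst (_ ∈_) (sym Q₁≡P++R) a∈)

  endsOnly : ∀ {L} → (∀ {a} → a ∈ L → a ∈ P ++ R ⊎ a ∉ vs) → ∀ {a} → a ∈ L → a ∈ vs → a ≡ u ⊎ a ≡ v
  endsOnly L⊆ a∈ a∈C with L⊆ a∈
  ... | inj₁ a∈PR = onQ₁⇒end a∈PR a∈C
  ... | inj₂ a∉C  = ⊥-elim (a∉C a∈C)

  P-linked : Linked (Adj H) P
  P-linked = linked-++⁻ˡ P Pw-linked

  R-linked : Linked (Adj H) R
  R-linked = linked-++⁻ˡ R RKu-linked

  P-unique : Unique P
  P-unique = proj₁ (unique-++⁻ P PR-unique)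

  R-unique : Unique R
  R-unique = proj₁ (proj₂ (unique-++⁻ P PR-unique))

  y≢w : y ≢ w
  y≢w refl = irrefl H wy

  y∉R : y ∉ B → y ∉ R
  y∉R y∉B (here y≡w) = y≢w y≡w
  y∉R y∉B (there y∈B) = y∉B y∈B

  y∉P++R : y ∉ P → y ∉ B → y ∉ P ++ R
  y∉P++R y∉P y∉B y∈ with ∈-++⁻ P y∈
  ... | inj₁ y∈P = y∉P y∈P
  ... | inj₂ y∈R = y∉R y∉B y∈R

  -- L is the new ear, from s to t, and T the way back from t to s
  record Route (s t : V) (L T : List V) : Set where
    field
      starts    : StartsWith s L
      ends      : EndsWith t L
      distinct  : Unique L
      linked    : Linked (Adj H) L
      back      : Linked (Adj H) (t ∷ T ++ [ s ])
      s∈C       : s ∈ vs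
      t∈C       : t ∈ vs
      ends-only : ∀ {a} → a ∈ L → a ∈ vs → a ≡ s ⊎ a ≡ t
      edge      : EdgeOn w y L

  route-closure : ∀ {s t L T} → Route s t L T → Linked (Adj H) (L ++ T ++ [ s ])
  route-closure r = linked-glue ends linked back
    where open Route r

  Detour : Set
  Detour = Σ (Ear H C) λ Q₂ → EdgeOn w y (earVerts Q₂) × length (𝔠 H C Q₂) ≤ c + 2

  route⇒detour : ∀ {s t L T} → Route s t L T → length L + length T ≡ c + 2 → Detour
  route⇒detour {L = L} {T} r total
    with earThrough L starts ends distinct linked s∈C t∈C ends-only edge wy∉C
    where open Route r
  ... | Q₂ , refl , refl = Q₂ , edge , 𝔠≤closure Q₂ T (route-closure r) total c+2-odd
    where open Route r

  c+2-or-c+4 : ∀ {m} → m ≡ c + 2 ⊎ m ≡ c + 4 → parity m ≡ true × m ≤ c + 2 + 2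
  c+2-or-c+4 (inj₁ refl) = c+2-odd , m≤m+n (c + 2) 2
  c+2-or-c+4 (inj₂ refl) = c+4-odd , ≤-reflexive (sym (+-assoc c 2 2))

  route+loop⇒detour : ∀ {s t L T a m} {Lp : List V} → Route s t L T → ClosedWalk H a Lp →
                      length L + length T + suc (length Lp) ≡ m → m ≡ c + 2 ⊎ m ≡ c + 4 → Detour
  route+loop⇒detour {L = L} {T} {Lp = Lp} r loop total m≡
    with earThrough L starts ends distinct linked s∈C t∈C ends-only edge wy∉C
    where open Route r
  ... | Q₂ , refl , refl = Q₂ , edge , 𝔠≤closure+loop Q₂ T Lp (route-closure r) loop total (proj₁ (c+2-or-c+4 m≡)) (proj₂ (c+2-or-c+4 m≡))
    where open Route r

  private
    lengths≡c+2 : ∀ {m} → m ≡ length P + length R + length K + 2 → m ≡ c + 2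
    lengths≡c+2 e = trans e (cong (_+ 2) (sym c≡))

  y∈P⇒detour : y ∈ P → Detour
  y∈P⇒detour y∈P with ∈-∃++ y∈P
  ... | P₁ , P₂ , P≡ = route+loop⇒detour route loop total (inj₁ refl)
    where
    Pw≡ : P ++ [ w ] ≡ P₁ ++ y ∷ P₂ ++ [ w ]
    Pw≡ = trans (cong (_++ [ w ]) P≡) (++-assoc P₁ (y ∷ P₂) [ w ])
    PR≡ : P ++ R ≡ P₁ ++ y ∷ P₂ ++ R
    PR≡ = trans (cong (_++ R) P≡) (++-assoc P₁ (y ∷ P₂) R)
    route : Route u v (P₁ ++ y ∷ R) K
    route = record
      { starts    = startsWith-splice P₁ (subst (StartsWith u) P≡ startsP)
      ; ends      = endsWith-++ P₁ (endsWith-∷ endsR)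
      ; distinct  = unique-cut P₁ P₂ (subst Unique PR≡ PR-unique)
      ; linked    = linked-join P₁ (linked-prefix P₁ (subst (Linked (Adj H)) Pw≡ Pw-linked)) (sym-adj wy ∷ R-linked)
      ; back      = arc-linked arc
      ; s∈C       = first∈C Q₁
      ; t∈C       = final∈C Q₁
      ; ends-only = endsOnly (λ {a} a∈ → inj₁ (subst (a ∈_) (sym PR≡) (∈-cut P₁ P₂ a∈)))
      ; edge      = EdgeOn-++⁺ʳ P₁ here-ba }
    loop : ClosedWalk H y (P₂ ++ [ w ])
    loop = linked-snoc (y ∷ P₂) (linked-++⁻ʳ P₁ (subst (Linked (Adj H)) Pw≡ Pw-linked)) wy
    total : length (P₁ ++ y ∷ R) + length K + suc (length (P₂ ++ [ w ])) ≡ c + 2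
    total = lengths≡c+2 (begin
      length (P₁ ++ y ∷ R) + length K + suc (length (P₂ ++ [ w ]))   ≡⟨ cong₂ (λ a b → a + length K + suc b) (length-++ P₁) (length-++ P₂) ⟩
      length P₁ + suc (length R) + length K + suc (length P₂ + 1)   ≡⟨ shuffle (length P₁) (length P₂) (length R) (length K) ⟩
      length P₁ + suc (length P₂) + length R + length K + 2         ≡⟨ cong (λ p → p + length R + length K + 2) (trans (cong length P≡) (length-++ P₁)) ⟨
      length P + length R + length K + 2                            ∎)
      where
      open ≡-Reasoning
      shuffle : ∀ a b r k → a + suc r + k + suc (b + 1) ≡ a + suc b + r + k + 2
      shuffle = solve-∀

  y∈B⇒detour : y ∈ B → Detour
  y∈B⇒detour y∈B with ∈-∃++ y∈B
  ... | B₁ , B₂ , B≡ = route+loop⇒detour route loop total (inj₁ refl)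
    where
    R≡ : R ≡ w ∷ B₁ ++ y ∷ B₂
    R≡ = cong (w ∷_) B≡
    R-linked′ : Linked (Adj H) (w ∷ B₁ ++ y ∷ B₂)
    R-linked′ = subst (Linked (Adj H)) R≡ R-linked
    route : Route u v (P ++ w ∷ y ∷ B₂) K
    route = record
      { starts    = startsWith-++ startsP
      ; ends      = endsWith-++ P (endsWith-∷ (endsWith-suffix (w ∷ B₁) (subst (EndsWith v) R≡ endsR)))
      ; distinct  = unique-cut P B₁ (subst (Unique ∘ (P ++_)) R≡ PR-unique)
      ; linked    = linked-join P Pw-linked (wy ∷ linked-++⁻ʳ (w ∷ B₁) R-linked′)
      ; back      = arc-linked arc
      ; s∈C       = first∈C Q₁
      ; t∈C       = final∈C Q₁
      ; ends-only = endsOnly (λ {a} a∈ → inj₁ (subst ((a ∈_) ∘ (P ++_)) (sym R≡) (∈-cut P B₁ a∈)))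
      ; edge      = EdgeOn-++⁺ʳ P here-ab }
    loop : ClosedWalk H w (B₁ ++ [ y ])
    loop = linked-snoc (w ∷ B₁) (linked-prefix (w ∷ B₁) R-linked′) (sym-adj wy)
    total : length (P ++ w ∷ y ∷ B₂) + length K + suc (length (B₁ ++ [ y ])) ≡ c + 2
    total = lengths≡c+2 (begin
      length (P ++ w ∷ y ∷ B₂) + length K + suc (length (B₁ ++ [ y ]))   ≡⟨ cong₂ (λ a b → a + length K + suc b) (length-++ P) (length-++ B₁) ⟩
      length P + suc (suc (length B₂)) + length K + suc (length B₁ + 1)   ≡⟨ shuffle (length P) (length B₁) (length B₂) (length K) ⟩
      length P + suc (length B₁ + suc (length B₂)) + length K + 2         ≡⟨ cong (λ r → length P + r + length K + 2) (trans (cong length R≡) (cong suc (length-++ B₁))) ⟨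
      length P + length R + length K + 2                                  ∎)
      where
      open ≡-Reasoning
      shuffle : ∀ p a b k → p + suc (suc b) + k + suc (a + 1) ≡ p + suc (a + suc b) + k + 2
      shuffle = solve-∀

  y∈C⇒detour : y ∈ vs → y ∉ P → Detour
  y∈C⇒detour y∈C y∉P = route⇒detour route total
    where
    ends-only′ : ∀ {a} → a ∈ P ++ w ∷ [ y ] → a ∈ vs → a ≡ u ⊎ a ≡ y
    ends-only′ a∈ a∈C with ∈-++⁻ P a∈
    ... | inj₂ (here refl)         = ⊥-elim (wy∉C (adjacentOnC⇒edge a∈C y∈C wy))
    ... | inj₂ (there (here refl)) = inj₂ refl
    ... | inj₁ a∈P with onQ₁⇒end (∈-++⁺ˡ a∈P) a∈C
    ...   | inj₁ a≡u  = inj₁ a≡u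
    ...   | inj₂ refl = ⊥-elim (P∩R a∈P (endsWith-∈ endsR))
    route : Route u y (P ++ w ∷ [ y ]) (R ++ K)
    route = record
      { starts    = startsWith-++ startsP
      ; ends      = P ++ [ w ] , sym (++-assoc P [ w ] [ y ])
      ; distinct  = unique-++⁺ P P-unique (unique-∷⁺ (λ { (here w≡y) → y≢w (sym w≡y) }) (unique-∷⁺ (λ ()) []))
                      λ { a∈P (here refl) → P∩R a∈P (here refl) ; a∈P (there (here refl)) → y∉P a∈P }
      ; linked    = linked-join P Pw-linked (wy ∷ [-])
      ; back      = subst (Linked (Adj H) ∘ (y ∷_)) (sym (++-assoc R K [ u ])) (sym-adj wy ∷ RKu-linked)
      ; s∈C       = first∈C Q₁
      ; t∈C       = y∈C
      ; ends-only = ends-only′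
      ; edge      = EdgeOn-++⁺ʳ P here-ab }
    total : length (P ++ w ∷ [ y ]) + length (R ++ K) ≡ c + 2
    total = lengths≡c+2 (trans (cong₂ _+_ (length-++ P) (length-++ R)) (shuffle (length P) (length R) (length K)))
      where
      shuffle : ∀ p r k → p + 2 + (r + k) ≡ p + r + k + 2
      shuffle = solve-∀

  z≢y : z ≢ y
  z≢y refl = irrefl H yz

  offC-or-onQ₁ : ∀ {a b} → a ∉ vs → b ≡ a ⊎ b ∈ P ++ R → b ∈ P ++ R ⊎ b ∉ vs
  offC-or-onQ₁ a∉C (inj₁ refl) = inj₂ a∉C
  offC-or-onQ₁ a∉C (inj₂ b∈)   = inj₁ b∈

  z∈B⇒detour : y ∉ P → y ∉ B → y ∉ vs → z ∈ B → Detour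
  z∈B⇒detour y∉P y∉B y∉C z∈B with ∈-∃++ z∈B
  ... | B₁ , B₂ , B≡ = route+loop⇒detour route loop total (inj₂ refl)
    where
    R≡ : R ≡ w ∷ B₁ ++ z ∷ B₂
    R≡ = cong (w ∷_) B≡
    R-linked′ : Linked (Adj H) (w ∷ B₁ ++ z ∷ B₂)
    R-linked′ = subst (Linked (Adj H)) R≡ R-linked
    toPR : ∀ {a} → a ∈ P ++ w ∷ z ∷ B₂ → a ∈ P ++ R
    toPR {a} a∈ = subst ((a ∈_) ∘ (P ++_)) (sym R≡) (∈-cut P B₁ a∈)
    route : Route u v (P ++ w ∷ y ∷ z ∷ B₂) K
    route = record
      { starts    = startsWith-++ startsP
      ; ends      = endsWith-++ P (endsWith-∷ (endsWith-∷ (endsWith-suffix (w ∷ B₁) (subst (EndsWith v) R≡ endsR))))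
      ; distinct  = unique-insertAfter P (unique-cut P B₁ (subst (Unique ∘ (P ++_)) R≡ PR-unique)) (y∉P++R y∉P y∉B ∘ toPR)
      ; linked    = linked-join P Pw-linked (wy ∷ yz ∷ linked-++⁻ʳ (w ∷ B₁) R-linked′)
      ; back      = arc-linked arc
      ; s∈C       = first∈C Q₁
      ; t∈C       = final∈C Q₁
      ; ends-only = endsOnly (λ a∈ → offC-or-onQ₁ y∉C (Data.Sum.map₂ toPR (∈-removeAfter P a∈)))
      ; edge      = EdgeOn-++⁺ʳ P here-ab }
    loop : ClosedWalk H w (B₁ ++ z ∷ [ y ])
    loop = subst (Linked (Adj H) ∘ (w ∷_)) (sym (++-assoc B₁ (z ∷ [ y ]) [ w ]))
             (linked-join (w ∷ B₁) (linked-prefix (w ∷ B₁) R-linked′) (sym-adj yz ∷ sym-adj wy ∷ [-]))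
    total : length (P ++ w ∷ y ∷ z ∷ B₂) + length K + suc (length (B₁ ++ z ∷ [ y ])) ≡ c + 4
    total = trans (begin
      length (P ++ w ∷ y ∷ z ∷ B₂) + length K + suc (length (B₁ ++ z ∷ [ y ]))   ≡⟨ cong₂ (λ a b → a + length K + suc b) (length-++ P) (length-++ B₁) ⟩
      length P + suc (suc (suc (length B₂))) + length K + suc (length B₁ + 2)    ≡⟨ shuffle (length P) (length B₁) (length B₂) (length K) ⟩
      length P + suc (length B₁ + suc (length B₂)) + length K + 4                ≡⟨ cong (λ r → length P + r + length K + 4) (trans (cong length R≡) (cong suc (length-++ B₁))) ⟨
      length P + length R + length K + 4                                         ∎) (cong (_+ 4) (sym c≡))
      where
      open ≡-Reasoning
      shuffle : ∀ p a b k → p + suc (suc (suc b)) + k + suc (a + 2) ≡ p + suc (a + suc b) + k + 4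
      shuffle = solve-∀

  z∈P⇒detour : y ∉ P → y ∉ B → y ∉ vs → z ∈ P → Detour
  z∈P⇒detour y∉P y∉B y∉C z∈P with ∈-∃++ z∈P
  ... | P₁ , P₂ , P≡ = route+loop⇒detour route loop total (inj₁ refl)
    where
    PR≡ : P ++ R ≡ P₁ ++ z ∷ P₂ ++ R
    PR≡ = trans (cong (_++ R) P≡) (++-assoc P₁ (z ∷ P₂) R)
    toPR : ∀ {a} → a ∈ P₁ ++ z ∷ R → a ∈ P ++ R
    toPR {a} a∈ = subst (a ∈_) (sym PR≡) (∈-cut P₁ P₂ a∈)
    P-linked′ : Linked (Adj H) (P₁ ++ z ∷ P₂)
    P-linked′ = subst (Linked (Adj H)) P≡ P-linked
    route : Route u v (P₁ ++ z ∷ y ∷ R) K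
    route = record
      { starts    = startsWith-splice P₁ (subst (StartsWith u) P≡ startsP)
      ; ends      = endsWith-++ P₁ (endsWith-∷ (endsWith-∷ endsR))
      ; distinct  = unique-insertAfter P₁ (unique-cut P₁ P₂ (subst Unique PR≡ PR-unique)) (y∉P++R y∉P y∉B ∘ toPR)
      ; linked    = linked-join P₁ (linked-prefix P₁ P-linked′) (sym-adj yz ∷ sym-adj wy ∷ R-linked)
      ; back      = arc-linked arc
      ; s∈C       = first∈C Q₁
      ; t∈C       = final∈C Q₁
      ; ends-only = endsOnly (λ a∈ → offC-or-onQ₁ y∉C (Data.Sum.map₂ toPR (∈-removeAfter P₁ a∈)))
      ; edge      = EdgeOn-++⁺ʳ P₁ (there here-ba) }
    loop : ClosedWalk H z P₂
    loop = linked-glue (endsWith-suffix P₁ (subst (EndsWith x) P≡ (A , refl))) (linked-++⁻ʳ P₁ P-linked′) (sym-adj zx ∷ [-])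
    total : length (P₁ ++ z ∷ y ∷ R) + length K + suc (length P₂) ≡ c + 2
    total = lengths≡c+2 (begin
      length (P₁ ++ z ∷ y ∷ R) + length K + suc (length P₂)       ≡⟨ cong (λ a → a + length K + suc (length P₂)) (length-++ P₁) ⟩
      length P₁ + suc (suc (length R)) + length K + suc (length P₂) ≡⟨ shuffle (length P₁) (length P₂) (length R) (length K) ⟩
      length P₁ + suc (length P₂) + length R + length K + 2        ≡⟨ cong (λ p → p + length R + length K + 2) (trans (cong length P≡) (length-++ P₁)) ⟨
      length P + length R + length K + 2                           ∎)
      where
      open ≡-Reasoning
      shuffle : ∀ a b r k → a + suc (suc r) + k + suc b ≡ a + suc b + r + k + 2
      shuffle = solve-∀

  z∈C⇒detour : y ∉ B → y ∉ vs → z ∉ B → z ∈ vs → Detour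
  z∈C⇒detour y∉B y∉C z∉B z∈C = route⇒detour route total
    where
    z∉R : z ∉ R
    z∉R (here z≡w)  = w≢z (sym z≡w)
    z∉R (there z∈B) = z∉B z∈B
    ends-only′ : ∀ {a} → a ∈ z ∷ y ∷ R → a ∈ vs → a ≡ z ⊎ a ≡ v
    ends-only′ (here refl)         _   = inj₁ refl
    ends-only′ (there (here refl)) a∈C = ⊥-elim (y∉C a∈C)
    ends-only′ (there (there a∈R)) a∈C with onQ₁⇒end (∈-++⁺ʳ P a∈R) a∈C
    ... | inj₁ refl = ⊥-elim (P∩R (startsWith-∈ startsP) a∈R)
    ... | inj₂ a≡v  = inj₂ a≡v
    Pz-linked : Linked (Adj H) (u ∷ proj₁ startsP ++ [ z ])
    Pz-linked = subst (Linked (Adj H) ∘ (_++ [ z ])) (proj₂ startsP) (linked-snoc A P-linked (sym-adj zx))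
    route : Route z v (z ∷ y ∷ R) (K ++ P)
    route = record
      { starts    = y ∷ R , refl
      ; ends      = endsWith-∷ (endsWith-∷ endsR)
      ; distinct  = unique-∷⁺ (λ { (here z≡y) → z≢y z≡y ; (there z∈R) → z∉R z∈R }) (unique-∷⁺ (y∉R y∉B) R-unique)
      ; linked    = sym-adj yz ∷ sym-adj wy ∷ R-linked
      ; back      = subst (λ T → Linked (Adj H) (v ∷ T)) (trans (sym (++-assoc K (u ∷ proj₁ startsP) [ z ])) (cong ((_++ [ z ]) ∘ (K ++_)) (sym (proj₂ startsP))))
                      (linked-join (v ∷ K) (arc-linked arc) Pz-linked)
      ; s∈C       = z∈C
      ; t∈C       = final∈C Q₁
      ; ends-only = ends-only′
      ; edge      = there here-ba }
    total : length (z ∷ y ∷ R) + length (K ++ P) ≡ c + 2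
    total = lengths≡c+2 (trans (cong (suc (suc (length R)) +_) (length-++ K)) (shuffle (length P) (length R) (length K)))
      where
      shuffle : ∀ p r k → suc (suc r) + (k + p) ≡ p + r + k + 2
      shuffle = solve-∀

  z-off⇒detour : y ∉ P → y ∉ B → y ∉ vs → z ∉ P → z ∉ B → z ∉ vs → Detour
  z-off⇒detour y∉P y∉B y∉C z∉P z∉B z∉C = route⇒detour route total
    where
    z∉ : z ∉ P ++ y ∷ R
    z∉ z∈ with ∈-remove P z∈
    ... | inj₁ z≡y = z≢y z≡y
    ... | inj₂ z∈PR with ∈-++⁻ P z∈PR
    ...   | inj₁ z∈P          = z∉P z∈P
    ...   | inj₂ (here z≡w)   = w≢z (sym z≡w)
    ...   | inj₂ (there z∈B)  = z∉B z∈B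
    onQ₁-or-offC : ∀ {a} → a ∈ P ++ z ∷ y ∷ R → a ∈ P ++ R ⊎ a ∉ vs
    onQ₁-or-offC a∈ with ∈-remove P a∈
    ... | inj₁ refl = inj₂ z∉C
    ... | inj₂ a∈′  = offC-or-onQ₁ y∉C (∈-remove P a∈′)
    route : Route u v (P ++ z ∷ y ∷ R) K
    route = record
      { starts    = startsWith-++ startsP
      ; ends      = endsWith-++ P (endsWith-∷ (endsWith-∷ endsR))
      ; distinct  = unique-insert P (y ∷ R) (unique-insert P R PR-unique (y∉P++R y∉P y∉B)) z∉
      ; linked    = linked-glue (A , refl) P-linked (sym-adj zx ∷ sym-adj yz ∷ sym-adj wy ∷ R-linked)
      ; back      = arc-linked arc
      ; s∈C       = first∈C Q₁
      ; t∈C       = final∈C Q₁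
      ; ends-only = endsOnly onQ₁-or-offC
      ; edge      = EdgeOn-++⁺ʳ P (there here-ba) }
    total : length (P ++ z ∷ y ∷ R) + length K ≡ c + 2
    total = lengths≡c+2 (trans (cong (_+ length K) (length-++ P)) (shuffle (length P) (length R) (length K)))
      where
      shuffle : ∀ p r k → p + suc (suc r) + k ≡ p + r + k + 2
      shuffle = solve-∀

  detour : Detour
  detour with y ∈? P
  ... | yes y∈P = y∈P⇒detour y∈P
  ... | no y∉P with y ∈? B
  ...   | yes y∈B = y∈B⇒detour y∈B
  ...   | no y∉B with y ∈? vs
  ...     | yes y∈C = y∈C⇒detour y∈C y∉P
  ...     | no y∉C with z ∈? B
  ...       | yes z∈B = z∈B⇒detour y∉P y∉B y∉C z∈B
  ...       | no z∉B with z ∈? P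
  ...         | yes z∈P = z∈P⇒detour y∉P y∉B y∉C z∈P
  ...         | no z∉P with z ∈? vs
  ...           | yes z∈C = z∈C⇒detour y∉B y∉C z∉B z∈C
  ...           | no z∉C  = z-off⇒detour y∉P y∉B y∉C z∉P z∉B z∉C

module _ {n : ℕ} (H : Graph n) where

  Prec-trans : ∀ {a b c} → Prec H c b → Prec H b a → Prec H c a
  Prec-trans {b = b} c≺b b≺a ℓ odd a≤ℓ ℓ≤c with ℓ ≤? b
  ... | yes ℓ≤b = b≺a ℓ odd a≤ℓ ℓ≤b
  ... | no ℓ≰b  = c≺b ℓ odd (<⇒≤ (≰⇒> ℓ≰b)) ℓ≤c

  -- between two odd lengths at most 2 apart there is no third odd length
  Prec-+2 : ∀ {a b} → Odd a → Σ (Cycle H) (λ Z → len Z ≡ a) → Σ (Cycle H) (λ Z → len Z ≡ b) → b ≤ a + 2 → Prec H b a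
  Prec-+2 {a} {b} odd-a (X , lenX) _ _ ℓ odd-ℓ a≤ℓ ℓ≤b with m≤n⇒m<n∨m≡n a≤ℓ
  ... | inj₂ refl = X , lenX
  ... | inj₁ a<ℓ with m≤n⇒m<n∨m≡n a<ℓ
  ...   | inj₂ refl = case trans (sym (Odd⇒parity (suc a) odd-ℓ)) (cong not (Odd⇒parity a odd-a)) of λ ()
  Prec-+2 {a} {b} odd-a _ (Y , lenY) b≤a+2 ℓ odd-ℓ a≤ℓ ℓ≤b | inj₁ a<ℓ | inj₁ a+1<ℓ =
    Y , trans lenY (≤-antisym (≤-trans b≤a+2 (subst (_≤ ℓ) (+-comm 2 a) a+1<ℓ)) ℓ≤b)

module _ {n : ℕ} {H : Graph n} {C : Cycle H} (shortest : ShortestOddCycle H C) where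
  open Ears {C = C} shortest

  private
    V : Set
    V = Fin n
    ∣𝔠_∣ : Ear H C → ℕ
    ∣𝔠 Q ∣ = length (𝔠 H C Q)

  -- if Q₁ runs from w to x, the detour is taken along the reversed ear
  detourStep : (Q₁ : Ear H C) {x w y z : V} → EdgeOn x w (earVerts Q₁) →
               Adj H x w → Adj H w y → Adj H y z → Adj H z x → w ≢ z → ¬ EdgeOf H C w y →
               Σ (Ear H C) λ Q₂ → EdgeOn w y (earVerts Q₂) × ∣𝔠 Q₂ ∣ ≤ ∣𝔠 Q₁ ∣ + 2
  detourStep Q₁ xw∈Q₁ xw wy yz zx w≢z wy∉C with EdgeOn⇒split xw∈Q₁
  ... | A , B , inj₁ split = Detour.detour shortest Q₁ A B split xw wy yz zx w≢z wy∉C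
  ... | A , B , inj₂ split with Detour.detour shortest (reverseEar Q₁) (reverse B) (reverse A) split′ xw wy yz zx w≢z wy∉C
    where
    split′ : earVerts (reverseEar Q₁) ≡ reverse B ++ _ ∷ _ ∷ reverse A
    split′ = trans (sym (reverse-∷-++ _ (interior Q₁) _)) (trans (cong reverse split) (reverse-++-∷-∷ A _ _ B))
  ...   | Q₂ , wy∈Q₂ , bound = Q₂ , wy∈Q₂ , ≤-trans bound (+-monoˡ-≤ 2 (𝔠-reverseEar≤ Q₁))

  record Square : Set where
    field
      s₀ s₁ s₂ s₃ : V
      s₀s₁ : Adj H s₀ s₁
      s₁s₂ : Adj H s₁ s₂
      s₂s₃ : Adj H s₂ s₃
      s₃s₀ : Adj H s₃ s₀
      s₀≢s₂ : s₀ ≢ s₂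
      s₁≢s₃ : s₁ ≢ s₃
      s₀s₁∉C : ¬ EdgeOf H C s₀ s₁
      s₁s₂∉C : ¬ EdgeOf H C s₁ s₂
      s₂s₃∉C : ¬ EdgeOf H C s₂ s₃
      s₃s₀∉C : ¬ EdgeOf H C s₃ s₀

    walk : List V
    walk = s₀ ∷ s₁ ∷ s₂ ∷ s₃ ∷ [ s₀ ]
  open Square

  rotate : Square → Square
  rotate S = record
    { s₀ = s₁ S ; s₁ = s₂ S ; s₂ = s₃ S ; s₃ = s₀ S
    ; s₀s₁ = s₁s₂ S ; s₁s₂ = s₂s₃ S ; s₂s₃ = s₃s₀ S ; s₃s₀ = s₀s₁ S
    ; s₀≢s₂ = s₁≢s₃ S ; s₁≢s₃ = s₀≢s₂ S ∘ sym
    ; s₀s₁∉C = s₁s₂∉C S ; s₁s₂∉C = s₂s₃∉C S ; s₂s₃∉C = s₃s₀∉C S ; s₃s₀∉C = s₀s₁∉C S }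

  reflect : Square → Square
  reflect S = record
    { s₀ = s₁ S ; s₁ = s₀ S ; s₂ = s₃ S ; s₃ = s₂ S
    ; s₀s₁ = Graph.sym H (s₀s₁ S) ; s₁s₂ = Graph.sym H (s₃s₀ S) ; s₂s₃ = Graph.sym H (s₂s₃ S) ; s₃s₀ = Graph.sym H (s₁s₂ S)
    ; s₀≢s₂ = s₁≢s₃ S ; s₁≢s₃ = s₀≢s₂ S
    ; s₀s₁∉C = s₀s₁∉C S ∘ EdgeOn-sym ; s₁s₂∉C = s₃s₀∉C S ∘ EdgeOn-sym
    ; s₂s₃∉C = s₂s₃∉C S ∘ EdgeOn-sym ; s₃s₀∉C = s₁s₂∉C S ∘ EdgeOn-sym }

  squareStep : (S : Square) (Q : Ear H C) → EdgeOn (s₀ S) (s₁ S) (earVerts Q) →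
               Σ (Ear H C) λ Q′ → EdgeOn (s₁ S) (s₂ S) (earVerts Q′) × Prec H ∣𝔠 Q′ ∣ ∣𝔠 Q ∣
  squareStep S Q s₀s₁∈Q with detourStep Q s₀s₁∈Q (s₀s₁ S) (s₁s₂ S) (s₂s₃ S) (s₃s₀ S) (s₁≢s₃ S) (s₁s₂∉C S)
  ... | Q′ , s₁s₂∈Q′ , bound = Q′ , s₁s₂∈Q′ , Prec-+2 H (𝔠-odd Q) (𝔠-cycle Q) (𝔠-cycle Q′) bound

  private
    flip : ∀ {a b} (Q : Ear H C) → (Σ (Ear H C) λ Q′ → EdgeOn a b (earVerts Q′) × Prec H ∣𝔠 Q′ ∣ ∣𝔠 Q ∣) →
           Σ (Ear H C) λ Q′ → EdgeOn b a (earVerts Q′) × Prec H ∣𝔠 Q′ ∣ ∣𝔠 Q ∣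
    flip _ (Q′ , e , p) = Q′ , EdgeOn-sym e , p

    same : ∀ {a b : V} → SameEdge a b a b
    same = inj₁ (refl , refl)

    swapped : ∀ {a b : V} → SameEdge a b b a
    swapped = inj₂ (refl , refl)

    SameEdge-swap : ∀ {a b c d : V} → SameEdge b a c d → SameEdge a b c d
    SameEdge-swap (inj₁ (refl , refl)) = inj₂ (refl , refl)
    SameEdge-swap (inj₂ (refl , refl)) = inj₁ (refl , refl)

  twoSteps : (S : Square) (Q : Ear H C) → EdgeOn (s₀ S) (s₁ S) (earVerts Q) →
             Σ (Ear H C) λ Q′ → EdgeOn (s₂ S) (s₃ S) (earVerts Q′) × Prec H ∣𝔠 Q′ ∣ ∣𝔠 Q ∣
  twoSteps S Q e with squareStep S Q e
  ... | Q₁ , e₁ , Q₁≺Q with squareStep (rotate S) Q₁ e₁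
  ...   | Q₂ , e₂ , Q₂≺Q₁ = Q₂ , e₂ , Prec-trans H Q₂≺Q₁ Q₁≺Q

  fromFirstEdge : (S : Square) {a b : V} → EdgeOn a b (walk S) → ¬ SameEdge (s₀ S) (s₁ S) a b →
                  (Q : Ear H C) → EdgeOn (s₀ S) (s₁ S) (earVerts Q) →
                  Σ (Ear H C) λ Q′ → EdgeOn a b (earVerts Q′) × Prec H ∣𝔠 Q′ ∣ ∣𝔠 Q ∣
  fromFirstEdge S here-ab                         first≢ _ _ = ⊥-elim (first≢ same)
  fromFirstEdge S here-ba                         first≢ _ _ = ⊥-elim (first≢ swapped)
  fromFirstEdge S (there here-ab)                 _ Q e = squareStep S Q e
  fromFirstEdge S (there here-ba)                 _ Q e = flip Q (squareStep S Q e)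
  fromFirstEdge S (there (there here-ab))         _ Q e = twoSteps S Q e
  fromFirstEdge S (there (there here-ba))         _ Q e = flip Q (twoSteps S Q e)
  fromFirstEdge S (there (there (there here-ab))) _ Q e = flip Q (squareStep (reflect S) Q (EdgeOn-sym e))
  fromFirstEdge S (there (there (there here-ba))) _ Q e = squareStep (reflect S) Q (EdgeOn-sym e)
  fromFirstEdge S (there (there (there (there (there ())))))

  fromSameEdge : (S : Square) {a₁ b₁ a₂ b₂ : V} → SameEdge a₁ b₁ (s₀ S) (s₁ S) → EdgeOn a₂ b₂ (walk S) → ¬ SameEdge a₁ b₁ a₂ b₂ →
                 (Q : Ear H C) → EdgeOn a₁ b₁ (earVerts Q) →
                 Σ (Ear H C) λ Q′ → EdgeOn a₂ b₂ (earVerts Q′) × Prec H ∣𝔠 Q′ ∣ ∣𝔠 Q ∣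
  fromSameEdge S (inj₁ (refl , refl)) e₂ e₁≢e₂     = fromFirstEdge S e₂ e₁≢e₂
  fromSameEdge S (inj₂ (refl , refl)) e₂ e₁≢e₂ Q e = fromFirstEdge S e₂ (e₁≢e₂ ∘ SameEdge-swap) Q (EdgeOn-sym e)

  fromEdge : (S : Square) {a₁ b₁ a₂ b₂ : V} → EdgeOn a₁ b₁ (walk S) → EdgeOn a₂ b₂ (walk S) → ¬ SameEdge a₁ b₁ a₂ b₂ →
             (Q : Ear H C) → EdgeOn a₁ b₁ (earVerts Q) →
             Σ (Ear H C) λ Q′ → EdgeOn a₂ b₂ (earVerts Q′) × Prec H ∣𝔠 Q′ ∣ ∣𝔠 Q ∣
  fromEdge S here-ab                         = fromSameEdge S same
  fromEdge S here-ba                         = fromSameEdge S swapped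
  fromEdge S (there here-ab)                 = fromSameEdge (rotate S) same ∘ EdgeOn-rotate₄
  fromEdge S (there here-ba)                 = fromSameEdge (rotate S) swapped ∘ EdgeOn-rotate₄
  fromEdge S (there (there here-ab))         = fromSameEdge (rotate (rotate S)) same ∘ EdgeOn-rotate₄ ∘ EdgeOn-rotate₄
  fromEdge S (there (there here-ba))         = fromSameEdge (rotate (rotate S)) swapped ∘ EdgeOn-rotate₄ ∘ EdgeOn-rotate₄
  fromEdge S (there (there (there here-ab))) = fromSameEdge (rotate (rotate (rotate S))) same ∘ EdgeOn-rotate₄ ∘ EdgeOn-rotate₄ ∘ EdgeOn-rotate₄
  fromEdge S (there (there (there here-ba))) = fromSameEdge (rotate (rotate (rotate S))) swapped ∘ EdgeOn-rotate₄ ∘ EdgeOn-rotate₄ ∘ EdgeOn-rotate₄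
  fromEdge S (there (there (there (there (there ())))))

  squareOf : (D : Cycle H) → len D ≡ 4 → EdgeDisjoint H D C → Σ Square λ S → ∀ {a b} → EdgeOf H D a b → EdgeOn a b (walk S)
  squareOf D len≡4 disjoint = fromWalk (start D) (rest D) (cong pred len≡4) (unique D) (closed D) (disjoint _ _)
    where
    fromWalk : (d₀ : V) (ds : List V) → length ds ≡ 3 → Unique (d₀ ∷ ds) → Linked (Adj H) (d₀ ∷ ds ++ [ d₀ ]) →
               (∀ {a b} → EdgeOn a b (d₀ ∷ ds ++ [ d₀ ]) → ¬ EdgeOf H C a b) →
               Σ Square λ S → ∀ {a b} → EdgeOn a b (d₀ ∷ ds ++ [ d₀ ]) → EdgeOn a b (walk S)
    fromWalk d₀ (d₁ ∷ d₂ ∷ d₃ ∷ []) _ ((_ ∷ d₀≢d₂ ∷ _) ∷ (_ ∷ d₁≢d₃ ∷ _) ∷ _) (d₀d₁ ∷ d₁d₂ ∷ d₂d₃ ∷ d₃d₀ ∷ [-]) off = record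
      { s₀ = d₀ ; s₁ = d₁ ; s₂ = d₂ ; s₃ = d₃
      ; s₀s₁ = d₀d₁ ; s₁s₂ = d₁d₂ ; s₂s₃ = d₂d₃ ; s₃s₀ = d₃d₀
      ; s₀≢s₂ = d₀≢d₂ ; s₁≢s₃ = d₁≢d₃
      ; s₀s₁∉C = off here-ab ; s₁s₂∉C = off (there here-ab) ; s₂s₃∉C = off (there (there here-ab)) ; s₃s₀∉C = off (there (there (there here-ab))) }
      , λ e → e

proposition4p9 : ∀ {n : ℕ} (H : Graph n) (C : Cycle H) → ShortestOddCycle H C
    → (D : Cycle H) → len D ≡ 4 → EdgeDisjoint H D C
    → (a₁ b₁ a₂ b₂ : Fin n) → EdgeOf H D a₁ b₁ → EdgeOf H D a₂ b₂ → ¬ SameEdge a₁ b₁ a₂ b₂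
    → (Q₁ : Ear H C) → EdgeOn a₁ b₁ (earVerts Q₁)
    → Σ (Ear H C) λ Q₂ → EdgeOn a₂ b₂ (earVerts Q₂)
        × Prec H (length (𝔠 H C Q₂)) (length (𝔠 H C Q₁))
proposition4p9 H C shortest D len≡4 disjoint a₁ b₁ a₂ b₂ e₁ e₂ e₁≢e₂ Q₁ e₁∈Q₁ with squareOf shortest D len≡4 disjoint
... | S , onS = fromEdge shortest S (onS e₁) (onS e₂) e₁≢e₂ Q₁ e₁∈Q₁
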